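{- For every $n\ge 6$, $\displaystyle\sum_{F}\frac{1}{\mathrm{aut}(F)}>e$, where the sum runs over all unlabelled forests $F$ on $n$ vertices.
   Context: An unlabelled forest is an isomorphism class of forests; $\mathrm{aut}(F)$ is the number of automorphisms of $F$. -}

module Defs where

open import Data.Nat using (ℕ; zero; suc; _+_)
open import Data.Nat using (_!)
open import Data.Bool using (Bool; true; false; _∧_; _∨_; not; if_then_else_)
open import Data.Fin using (Fin; zero; suc; inject₁; fromℕ; _≟_)
open import Data.Fin.Permutation using (Permutation′; _⟨$⟩ʳ_)
open import Data.List using (List; []; _∷_; length; filterᵇ; map; lookup; allFin; foldr; concatMap)
open import Data.Vec as Vec using (Vec)
open import Data.Product using (Σ; ∃-syntax; _×_)
open import Data.Integer using (+_)
open import Data.Rational using (ℚ; 0ℚ; _/_; _<_; _≤_) renaming (_+_ to _+ℚ_)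
open import Relation.Binary.PropositionalEquality using (_≡_)
open import Relation.Nullary using (¬_; ⌊_⌋)
open import Function.Definitions using (Injective)

record Graph (n : ℕ) : Set where
  field
    adj    : Fin n → Fin n → Bool
    sym    : ∀ i j → adj i j ≡ adj j i
    irrefl : ∀ i → adj i i ≡ false
open Graph public

HasCycle : ∀ {n} → Graph n → Set
HasCycle {n} G =
  ∃[ k ] Σ (Fin (3 + k) → Fin n) λ f →
    Injective _≡_ _≡_ f
    × (∀ (i : Fin (2 + k)) → adj G (f (inject₁ i)) (f (suc i)) ≡ true)
    × adj G (f (fromℕ (2 + k))) (f zero) ≡ true

IsForest : ∀ {n} → Graph n → Set
IsForest G = ¬ HasCycle G

Isomorphic : ∀ {n} → Graph n → Graph n → Set
Isomorphic {n} G H =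
  Σ (Permutation′ n) λ σ → ∀ i j → adj H (σ ⟨$⟩ʳ i) (σ ⟨$⟩ʳ j) ≡ adj G i j

-- all maps Fin n → Fin m, represented as vectors (tables of values)
allVecs : (m k : ℕ) → List (Vec (Fin m) k)
allVecs m zero    = Vec.[] ∷ []
allVecs m (suc k) = concatMap (λ x → map (x Vec.∷_) (allVecs m k)) (allFin m)

allB : ∀ {n} → (Fin n → Bool) → Bool
allB p = foldr (λ i b → p i ∧ b) true (allFin _)

_==_ : ∀ {n} → Fin n → Fin n → Bool
i == j = ⌊ i ≟ j ⌋

_⇔ᵇ_ : Bool → Bool → Bool
a ⇔ᵇ b = if a then b else not b

-- σ (given by its table) is an automorphism of G: σ is injective
-- (hence a permutation of Fin n) and preserves adjacency.
isAutᵇ : ∀ {n} → Graph n → Vec (Fin n) n → Bool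
isAutᵇ G v = allB λ i → allB λ j →
  (not (Vec.lookup v i == Vec.lookup v j) ∨ (i == j))
  ∧ (adj G (Vec.lookup v i) (Vec.lookup v j) ⇔ᵇ adj G i j)

aut : ∀ {n} → Graph n → ℕ
aut {n} G = length (filterᵇ (isAutᵇ G) (allVecs n n))

-- 1/m for m ≥ 1 (value at 0 irrelevant; aut and k! are always ≥ 1)
inv : ℕ → ℚ
inv zero    = 0ℚ
inv (suc m) = + 1 / suc m

sumℚ : List ℚ → ℚ
sumℚ = foldr _+ℚ_ 0ℚ

eSum : ℕ → ℚ
eSum zero    = inv (0 !)
eSum (suc N) = eSum N +ℚ inv (suc N !)

-- e < q, with e = sup_N s N : there is r < q bounding all partial sums
e<_ : ℚ → Set
e< q = ∃[ r ] (r < q) × (∀ N → eSum N ≤ r)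

ForestReps : (n : ℕ) → List (Graph n) → Set
ForestReps n reps =
  (∀ i → IsForest (lookup reps i))
  × (∀ (G : Graph n) → IsForest G → ∃[ i ] Isomorphic G (lookup reps i))
  × (∀ i j → Isomorphic (lookup reps i) (lookup reps j) → i ≡ j)

module Submission where

-- Six explicit
-- forests already contribute enough: the path, one or two isolated vertices
-- plus a path, the fork (two leaves at the end of a path), an isolated vertex
-- plus a fork, and the spur (a path with a leaf at its fourth vertex).  Their
-- automorphism groups have at most 2, 2, 4, 2, 2, 2 elements, and four
-- isomorphism invariants tell them apart, so their representatives contribute
-- at least 5/2 + 1/4 = 11/4 > 68/25, while every partial sum of e is at most
-- 68/25.

open import Defs hiding (sym)
open import Data.Nat
  using (ℕ; zero; suc; pred; _+_; _∸_; _*_; _!; _≤_; _<_; s≤s; z≤n; _≤?_; _<?_; _≡ᵇ_; _≤ᵇ_)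
open import Data.Nat.Properties
  using (_≟_; ≡ᵇ⇒≡; ≡⇒≡ᵇ; ≤ᵇ⇒≤; ≤⇒≤ᵇ; <-cmp; <-irrefl; <-asym; ≤∧≢⇒<; 1+n≢n; suc-injective;
         ≤-refl; ≤-reflexive; ≤-trans; <-trans; ≤-<-trans; <-≤-trans; ≤-antisym; ≤-pred;
         <⇒≤; ≰⇒>; ≮⇒≥; <⇒≱;
         n<1+n; n≤1+n; n<1⇒n≡0; m≤n+m; m≤m+n; pred[n]≤n; 1≤n!;
         +-identityʳ; +-comm; +-suc; +-cancelʳ-≡; +-cancelˡ-≤; +-monoˡ-≤;
         m∸n+n≡m; m+n∸n≡m; m+n∸m≡n; m∸[m∸n]≡n; m+[n∸m]≡n;
         *-distribˡ-+; *-distribʳ-+; *-monoʳ-≤; *-monoˡ-≤)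
open import Data.Nat.DivMod using (_mod_; m%n<n; m<n⇒m%n≡m)
open import Data.Bool using (Bool; true; false; _∧_; _∨_; not; T; T?; if_then_else_)
open import Data.Bool.Properties using (∧-conicalˡ; ∧-conicalʳ; ∨-comm)
import Data.Bool.Properties as Boolₚ
open import Data.Maybe using (Maybe; just; nothing)
open import Data.Maybe.Properties using (just-injective)
open import Data.Product using (Σ; _,_; proj₁; proj₂; _×_; ∃-syntax)
open import Data.Sum using (_⊎_; inj₁; inj₂)
import Data.Sum as Sum
open import Data.Empty using (⊥; ⊥-elim)
open import Function using (_∘_)
open import Data.Fin using (Fin; zero; suc; toℕ; inject₁; fromℕ)
import Data.Fin as Fin
open import Data.Fin.Properties using (all?; injective⇒≤; toℕ-injective; toℕ-inject₁; toℕ<n; toℕ-fromℕ<)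
import Data.Fin.Properties as Finₚ
open import Data.Fin.Relation.Unary.Top using (view; ‵fromℕ; ‵inject₁)
open import Data.Fin.Permutation using (_⟨$⟩ʳ_; _⟨$⟩ˡ_; inverseˡ; inverseʳ; flip)
open import Data.List using (List; []; _∷_; map; length; lookup; allFin; foldr; concatMap; cartesianProductWith; _++_)
open import Data.List.Properties using (length-map; map-∘)
open import Data.List.Extrema.Nat using (argmin; f[argmin]≤f[xs])
open import Data.List.Relation.Unary.Any using (Any; here; there)
import Data.List.Relation.Unary.Any as Any
import Data.List.Relation.Unary.Any.Properties as Anyₚ
open import Data.List.Relation.Unary.All using ([]; _∷_)
import Data.List.Relation.Unary.All as All
open import Data.List.Relation.Unary.AllPairs using ([]; _∷_)
open import Data.List.Relation.Unary.Unique.Propositional using (Unique)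
import Data.List.Relation.Unary.Unique.Propositional.Properties as Uniqueₚ
open import Data.List.Membership.Propositional using (_∈_)
open import Data.List.Membership.Propositional.Properties
  using (∈-allFin; ∈-filter⁻; ∈-filter⁺; ∈-cartesianProductWith⁺; ∈-lookup)
open import Data.List.Membership.Setoid.Properties using (index-injective)
open import Data.Vec as Vec using (Vec; tabulate) renaming (_∷_ to _∷ᵥ_; [] to []ᵥ)
open import Data.Vec.Properties using (∷-injective; tabulate∘lookup; lookup∘tabulate; tabulate-cong)
import Data.Vec.Properties as Vecₚ
import Data.Integer as ℤ
import Data.Integer.Properties as ℤP
open import Data.Rational using (ℚ; 0ℚ; _/_; toℚᵘ)
import Data.Rational as ℚ
open import Data.Rational.Properties using (toℚᵘ-fromℚᵘ; toℚᵘ-cancel-≤; toℚᵘ-homo-+)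
import Data.Rational.Properties as ℚP
open import Data.Rational.Unnormalised using (ℚᵘ; mkℚᵘ; 0ℚᵘ; *≤*)
  renaming (_+_ to _+ᵘ_; _≤_ to _≤ᵘ_; _≃_ to _≃ᵘ_)
import Data.Rational.Unnormalised as ℚᵘ
open import Data.Rational.Unnormalised.Properties
  using (nonNegative⁻¹)
  renaming (≃-refl to ≃ᵘ-refl; ≃-sym to ≃ᵘ-sym; ≃-trans to ≃ᵘ-trans; ≤-refl to ≤ᵘ-refl;
            ≤-trans to ≤ᵘ-trans; _≤?_ to _≤ᵘ?_; +-assoc to +ᵘ-assoc; +-monoʳ-≤ to +ᵘ-monoʳ-≤;
            +-identityʳ to +ᵘ-identityʳ; +-cong to +ᵘ-cong;
            ≤-respˡ-≃ to ≤ᵘ-respˡ-≃; ≤-respʳ-≃ to ≤ᵘ-respʳ-≃)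
open import Relation.Binary.PropositionalEquality
  using (_≡_; _≢_; refl; sym; trans; cong; cong₂; subst; subst₂; setoid)
open import Relation.Binary.Definitions using (tri<; tri≈; tri>)
open import Relation.Nullary using (¬_; Dec; yes; no)
open import Relation.Nullary.Decidable using (True; toWitness; _→-dec_)
open import Relation.Nullary.Reflects using (Reflects; ofʸ; ofⁿ; det)

allB-sound : ∀ {n} (p : Fin n → Bool) → allB p ≡ true → ∀ i → p i ≡ true
allB-sound p all≡true i = go (allFin _) all≡true (∈-allFin i)
  where
  go : ∀ xs → foldr (λ j b → p j ∧ b) true xs ≡ true → i ∈ xs → p i ≡ true
  go (x ∷ xs) eq (here refl) = ∧-conicalˡ (p x) _ eq
  go (x ∷ xs) eq (there i∈) = go xs (∧-conicalʳ (p x) _ eq) i∈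

allB-complete : ∀ {n} (p : Fin n → Bool) → (∀ i → p i ≡ true) → allB p ≡ true
allB-complete p h = go (allFin _)
  where
  go : ∀ xs → foldr (λ j b → p j ∧ b) true xs ≡ true
  go []       = refl
  go (x ∷ xs) rewrite h x = go xs

==-sound : ∀ {n} {i j : Fin n} → (i == j) ≡ true → i ≡ j
==-sound {i = i} {j} eq = toWitness (subst T (sym eq) _)

==-refl : ∀ {n} (i : Fin n) → (i == i) ≡ true
==-refl i with i Fin.≟ i
... | yes _  = refl
... | no i≢i = ⊥-elim (i≢i refl)

⇔ᵇ-sound : ∀ {a b} → (a ⇔ᵇ b) ≡ true → a ≡ b
⇔ᵇ-sound {true}  {true}  _ = refl
⇔ᵇ-sound {false} {false} _ = refl

isAut-injective : ∀ {n} (G : Graph n) (v : Vec (Fin n) n) → isAutᵇ G v ≡ true →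
  ∀ i j → Vec.lookup v i ≡ Vec.lookup v j → i ≡ j
isAut-injective G v ok i j same = ==-sound (distinct⇒ (allB-sound _ (allB-sound _ ok i) j))
  where
  distinct⇒ : ∀ {rest} → ((not (Vec.lookup v i == Vec.lookup v j) ∨ (i == j)) ∧ rest) ≡ true →
              (i == j) ≡ true
  distinct⇒ eq rewrite same | ==-refl (Vec.lookup v j) = ∧-conicalˡ _ _ eq

isAut-preserves : ∀ {n} (G : Graph n) (v : Vec (Fin n) n) → isAutᵇ G v ≡ true →
  ∀ i j → adj G (Vec.lookup v i) (Vec.lookup v j) ≡ adj G i j
isAut-preserves G v ok i j = ⇔ᵇ-sound (∧-conicalʳ _ _ (allB-sound _ (allB-sound _ ok i) j))

isAut-identity : ∀ {n} (G : Graph n) → isAutᵇ G (tabulate (λ i → i)) ≡ true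
isAut-identity G = allB-complete _ λ i → allB-complete _ λ j →
  accepted (lookup∘tabulate (λ x → x) i) (lookup∘tabulate (λ x → x) j)
  where
  accepted : ∀ {i j a b} → a ≡ i → b ≡ j →
    ((not (a == b) ∨ (i == j)) ∧ (adj G a b ⇔ᵇ adj G i j)) ≡ true
  accepted {i} {j} refl refl with i == j | adj G i j
  ... | true  | true  = refl
  ... | true  | false = refl
  ... | false | true  = refl
  ... | false | false = refl

concatMap-as-product : ∀ {A B C : Set} (f : A → B → C) xs ys →
  concatMap (λ x → map (f x) ys) xs ≡ cartesianProductWith f xs ys
concatMap-as-product f []       ys = refl
concatMap-as-product f (x ∷ xs) ys = cong (map (f x) ys ++_) (concatMap-as-product f xs ys)

allVecs-complete : ∀ m k (v : Vec (Fin m) k) → v ∈ allVecs m k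
allVecs-complete m zero    Vec.[]       = here refl
allVecs-complete m (suc k) (x Vec.∷ v) =
  subst ((x Vec.∷ v) ∈_) (sym (concatMap-as-product Vec._∷_ (allFin m) (allVecs m k)))
    (∈-cartesianProductWith⁺ Vec._∷_ (∈-allFin x) (allVecs-complete m k v))

allVecs-unique : ∀ m k → Unique (allVecs m k)
allVecs-unique m zero    = [] ∷ []
allVecs-unique m (suc k) =
  subst Unique (sym (concatMap-as-product Vec._∷_ (allFin m) (allVecs m k)))
    (Uniqueₚ.cartesianProductWith⁺ Vec._∷_ ∷-injective (Uniqueₚ.allFin⁺ m) (allVecs-unique m k))

unique-lookup-injective : ∀ {A : Set} {xs : List A} → Unique xs →
  ∀ i j → lookup xs i ≡ lookup xs j → i ≡ j
unique-lookup-injective (_ ∷ _)   zero    zero    _  = refl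
unique-lookup-injective (x∉ ∷ _)  zero    (suc j) eq = ⊥-elim (All.lookup x∉ (∈-lookup j) eq)
unique-lookup-injective (x∉ ∷ _)  (suc i) zero    eq = ⊥-elim (All.lookup x∉ (∈-lookup i) (sym eq))
unique-lookup-injective (_ ∷ u)   (suc i) (suc j) eq = cong suc (unique-lookup-injective u i j eq)

unique-⊆⇒length≤ : ∀ {A : Set} {xs ys : List A} → Unique xs →
  (∀ {x} → x ∈ xs → x ∈ ys) → length xs ≤ length ys
unique-⊆⇒length≤ u sub = injective⇒≤ λ {i} {j} same-position →
  unique-lookup-injective u i j
    (index-injective (setoid _) (sub (∈-lookup i)) (sub (∈-lookup j)) same-position)

false≢true : false ≢ true
false≢true ()

T⇒≡true : ∀ {b} → T b → b ≡ true
T⇒≡true {true} _ = refl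

aut≤ : ∀ {n} (H : Graph n) (S : List (Vec (Fin n) n)) →
  (∀ v → isAutᵇ H v ≡ true → v ∈ S) → aut H ≤ length S
aut≤ {n} H S contains = unique-⊆⇒length≤
  (Uniqueₚ.filter⁺ (λ v → T? (isAutᵇ H v)) (allVecs-unique n n))
  (λ v∈ → contains _ (T⇒≡true (proj₂ (∈-filter⁻ (λ v → T? (isAutᵇ H v)) {xs = allVecs n n} v∈))))

-- The identity is an automorphism, so aut H ≥ 1.
aut≥1 : ∀ {n} (H : Graph n) → 1 ≤ aut H
aut≥1 {n} H = nonempty (∈-filter⁺ (λ v → T? (isAutᵇ H v))
  (allVecs-complete n n (tabulate (λ i → i))) (subst T (sym (isAut-identity H)) _))
  where
  nonempty : ∀ {A : Set} {x : A} {xs} → x ∈ xs → 1 ≤ length xs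
  nonempty (here _)  = s≤s z≤n
  nonempty (there _) = s≤s z≤n

IsAutomorphism : ∀ {n} → Graph n → (Fin n → Fin n) → Set
IsAutomorphism G ρ = (∀ i j → ρ i ≡ ρ j → i ≡ j) × (∀ i j → adj G (ρ i) (ρ j) ≡ adj G i j)

ListsAutomorphisms : ∀ {n} → Graph n → List (Fin n → Fin n) → Set
ListsAutomorphisms G fs = ∀ ρ → IsAutomorphism G ρ → Any (λ f → ∀ i → ρ i ≡ f i) fs

-- Conjugation by an isomorphism G ≅ H carries automorphisms of H to automorphisms
-- of G, so a list of all automorphisms of G bounds aut H.
aut≤-via-iso : ∀ {n} {G H : Graph n} → Isomorphic G H →
  (fs : List (Fin n → Fin n)) → ListsAutomorphisms G fs → aut H ≤ length fs
aut≤-via-iso {n} {G} {H} (π , π-iso) fs lists =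
  subst (aut H ≤_) (length-map conjugate fs) (aut≤ H (map conjugate fs) contains)
  where
  conjugate : (Fin n → Fin n) → Vec (Fin n) n
  conjugate f = tabulate (λ j → π ⟨$⟩ʳ f (π ⟨$⟩ˡ j))

  contains : ∀ v → isAutᵇ H v ≡ true → v ∈ map conjugate fs
  contains v v-ok = Anyₚ.map⁺ (Any.map table≡ (lists ρ (ρ-injective , ρ-preserves)))
    where
    ρ : Fin n → Fin n
    ρ i = π ⟨$⟩ˡ Vec.lookup v (π ⟨$⟩ʳ i)
    πρ : ∀ i → π ⟨$⟩ʳ ρ i ≡ Vec.lookup v (π ⟨$⟩ʳ i)
    πρ i = inverseʳ π
    ρ-injective : ∀ i j → ρ i ≡ ρ j → i ≡ j
    ρ-injective i j eq = trans (sym (inverseˡ π)) (trans (cong (π ⟨$⟩ˡ_)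
      (isAut-injective H v v-ok _ _ (trans (sym (πρ i)) (trans (cong (π ⟨$⟩ʳ_) eq) (πρ j)))))
      (inverseˡ π))
    ρ-preserves : ∀ i j → adj G (ρ i) (ρ j) ≡ adj G i j
    ρ-preserves i j = trans (sym (π-iso (ρ i) (ρ j)))
      (trans (cong₂ (adj H) (πρ i) (πρ j)) (trans (isAut-preserves H v v-ok _ _) (π-iso i j)))
    table≡ : ∀ {f} → (∀ i → ρ i ≡ f i) → v ≡ conjugate f
    table≡ {f} ρ≗f = trans (sym (tabulate∘lookup v)) (tabulate-cong λ j → trans
      (sym (trans (cong (λ x → π ⟨$⟩ʳ (π ⟨$⟩ˡ Vec.lookup v x)) (inverseʳ π)) (inverseʳ π)))
      (cong (π ⟨$⟩ʳ_) (ρ≗f (π ⟨$⟩ˡ j))))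

-- 3. Forests given by parent functions.

-- A parent function assigns to a vertex x at most one parent, which is larger than x.
Parent : Set
Parent = ℕ → Maybe ℕ

Increasing : Parent → Set
Increasing p = ∀ x y → p x ≡ just y → x < y

-- Adjacency is kept opaque: it is only used through the lemmas of this block.
opaque
  points : Maybe ℕ → ℕ → Bool
  points nothing  y = false
  points (just x) y = x ≡ᵇ y

  linked : Parent → ℕ → ℕ → Bool
  linked p x y = points (p x) y ∨ points (p y) x

  points-sound : ∀ m y → points m y ≡ true → m ≡ just y
  points-sound (just x) y eq = cong just (≡ᵇ⇒≡ x y (subst T (sym eq) _))

  points-refl : ∀ y → points (just y) y ≡ true
  points-refl y = T⇒≡true (≡⇒≡ᵇ y y refl)

  linked-sound : ∀ p x y → linked p x y ≡ true → (p x ≡ just y) ⊎ (p y ≡ just x)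
  linked-sound p x y eq with points (p x) y in px
  ... | true  = inj₁ (points-sound (p x) y px)
  ... | false = inj₂ (points-sound (p y) x eq)

  linked-up : ∀ p x y → p x ≡ just y → linked p x y ≡ true
  linked-up p x y px rewrite px | points-refl y = refl

  linked-sym : ∀ p x y → linked p x y ≡ linked p y x
  linked-sym p x y = ∨-comm (points (p x) y) (points (p y) x)

  linked-irrefl : ∀ p → Increasing p → ∀ x → linked p x x ≡ false
  linked-irrefl p inc x with linked p x x in e
  ... | false = refl
  ... | true with linked-sound p x x e
  ...   | inj₁ px = ⊥-elim (<-irrefl refl (inc x x px))
  ...   | inj₂ px = ⊥-elim (<-irrefl refl (inc x x px))

forestOf : (p : Parent) → Increasing p → (N : ℕ) → Graph N
forestOf p inc N = record
  { adj    = λ i j → linked p (toℕ i) (toℕ j)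
  ; sym    = λ i j → linked-sym p (toℕ i) (toℕ j)
  ; irrefl = λ i → linked-irrefl p inc (toℕ i) }

2+n≢n : ∀ (n : ℕ) → suc (suc n) ≢ n
2+n≢n (suc n) eq = 2+n≢n n (suc-injective eq)

module CycleNeighbours {N k} (G : Graph N) (f : Fin (3 + k) → Fin N)
  (path    : ∀ (i : Fin (2 + k)) → adj G (f (inject₁ i)) (f (suc i)) ≡ true)
  (closing : adj G (f (fromℕ (2 + k))) (f zero) ≡ true) where

  Neighbours : Fin (3 + k) → Set
  Neighbours m = Σ (Fin (3 + k)) λ p → Σ (Fin (3 + k)) λ q →
    (p ≢ q) × (p ≢ m) × (q ≢ m) × (adj G (f m) (f p) ≡ true) × (adj G (f m) (f q) ≡ true)

  private
    toℕ-≢ : ∀ {n} {i j : Fin n} → toℕ i ≢ toℕ j → i ≢ j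
    toℕ-≢ ne refl = ne refl

    inject₁≢suc : ∀ {n} (i : Fin n) → inject₁ i ≢ suc i
    inject₁≢suc i = toℕ-≢ λ eq → 1+n≢n (sym (trans (sym (toℕ-inject₁ i)) eq))

    back : ∀ {a b} → adj G a b ≡ true → adj G b a ≡ true
    back {a} {b} eq = trans (Graph.sym G b a) eq

  neighbours : ∀ m → Neighbours m
  neighbours zero = suc zero , fromℕ (2 + k) , (λ ()) , (λ ()) , (λ ()) , path zero , back closing
  neighbours (suc i) with view i
  ... | ‵fromℕ =
    zero , inject₁ (fromℕ (1 + k)) , (λ ()) , (λ ()) , inject₁≢suc (fromℕ (1 + k)) ,
    closing , back (path (fromℕ (1 + k)))
  ... | ‵inject₁ j =
    suc (suc j) , inject₁ (inject₁ j) ,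
    toℕ-≢ (λ eq → 2+n≢n _ (trans eq (trans (toℕ-inject₁ (inject₁ j)) (toℕ-inject₁ j)))) ,
    (λ eq → inject₁≢suc j (sym (Finₚ.suc-injective eq))) ,
    inject₁≢suc (inject₁ j) ,
    path (suc j) , back (path (inject₁ j))

minimum-attained : ∀ {n} (h : Fin (suc n) → ℕ) → Σ (Fin (suc n)) λ m → ∀ j → h m ≤ h j
minimum-attained h =
  argmin h zero (allFin _) , λ j → All.lookup (f[argmin]≤f[xs] {f = h} zero (allFin _)) (∈-allFin j)

-- Parent functions give forests: on a cycle, the vertex with the smallest label
-- would be joined to two distinct larger vertices, i.e. would have two parents.
forestOf-isForest : ∀ p (inc : Increasing p) N → IsForest (forestOf p inc N)
forestOf-isForest p inc N (k , f , f-inj , path , closing) =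
  no-two-parents (minimum-attained (λ j → toℕ (f j)))
  where
  open CycleNeighbours (forestOf p inc N) f path closing
  no-two-parents : ¬ (Σ (Fin (3 + k)) λ m → ∀ j → toℕ (f m) ≤ toℕ (f j))
  no-two-parents (m , minimal) with neighbours m
  ... | a , b , a≢b , a≢m , b≢m , ma , mb =
    a≢b (f-inj (toℕ-injective (just-injective (trans (sym (parent a a≢m ma)) (parent b b≢m mb)))))
    where
    parent : ∀ j → j ≢ m → adj (forestOf p inc N) (f m) (f j) ≡ true →
             p (toℕ (f m)) ≡ just (toℕ (f j))
    parent j j≢m joined with linked-sound p _ _ joined
    ... | inj₁ up   = up
    ... | inj₂ down = ⊥-elim (<-asym (inc _ _ down)
            (≤∧≢⇒< (minimal j) (λ eq → j≢m (sym (f-inj (toℕ-injective eq))))))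

record IsAutℕ (p : Parent) (N : ℕ) (s : ℕ → ℕ) : Set where
  field
    bounded   : ∀ x → x < N → s x < N
    injective : ∀ x y → x < N → y < N → s x ≡ s y → x ≡ y
    preserves : ∀ x y → x < N → y < N → linked p (s x) (s y) ≡ linked p x y

ListsAutℕ : Parent → ℕ → List (ℕ → ℕ) → Set
ListsAutℕ p N gs = ∀ s → IsAutℕ p N s → Any (λ g → ∀ x → x < N → s x ≡ g x) gs

images-distinct : ∀ {p N s} → IsAutℕ p N s → ∀ {x y} → x < N → y < N → x ≢ y → s x ≢ s y
images-distinct s-aut x<N y<N x≢y eq = x≢y (IsAutℕ.injective s-aut _ _ x<N y<N eq)

low-stays-low : ∀ {p L s} → IsAutℕ p (suc L) s → ∀ a → a ≤ L →
  (∀ y → a ≤ y → y < suc L → Σ ℕ λ x → (a ≤ x) × (x < suc L) × (s x ≡ y)) →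
  ∀ v → v < a → s v < a
low-stays-low {L = L} {s} s-aut a a≤L onto v v<a with s v <? a
... | yes sv<a = sv<a
... | no  sv≮a = ⊥-elim (<-irrefl refl (<-≤-trans v<a
        (preimage-above (onto (s v) (≮⇒≥ sv≮a) (IsAutℕ.bounded s-aut v v≤L)))))
  where
  v≤L : v < suc L
  v≤L = <-≤-trans v<a (≤-trans a≤L (n≤1+n L))
  preimage-above : (Σ ℕ λ x → (a ≤ x) × (x < suc L) × (s x ≡ s v)) → a ≤ v
  preimage-above (x , a≤x , x≤L , sx≡sv) = subst (a ≤_) (IsAutℕ.injective s-aut x v x≤L v≤L sx≡sv) a≤x

toFin : ∀ {M} → ℕ → Fin (suc M)
toFin {M} x = x mod suc M

toℕ-toFin : ∀ {M} x → x < suc M → toℕ (toFin {M} x) ≡ x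
toℕ-toFin {M} x x≤M = trans (toℕ-fromℕ< (m%n<n x (suc M))) (m<n⇒m%n≡m x≤M)

toFin-toℕ : ∀ {M} (i : Fin (suc M)) → toFin (toℕ i) ≡ i
toFin-toℕ i = toℕ-injective (toℕ-toFin (toℕ i) (toℕ<n i))

liftFin : ∀ {M} → (ℕ → ℕ) → Fin (suc M) → Fin (suc M)
liftFin g i = toFin (g (toℕ i))

lists-fromℕ : ∀ {M} p (inc : Increasing p) gs → ListsAutℕ p (suc M) gs →
  ListsAutomorphisms (forestOf p inc (suc M)) (map liftFin gs)
lists-fromℕ {M} p inc gs lists ρ (ρ-injective , ρ-preserves) =
  Anyₚ.map⁺ (Any.map agrees (lists s s-aut))
  where
  s : ℕ → ℕ
  s x = toℕ (ρ (toFin {M} x))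
  s-aut : IsAutℕ p (suc M) s
  s-aut = record
    { bounded   = λ x _ → toℕ<n (ρ (toFin x))
    ; injective = λ x y x< y< eq → trans (sym (toℕ-toFin x x<))
        (trans (cong toℕ (ρ-injective _ _ (toℕ-injective eq))) (toℕ-toFin y y<))
    ; preserves = λ x y x< y< →
        trans (ρ-preserves (toFin x) (toFin y)) (cong₂ (linked p) (toℕ-toFin x x<) (toℕ-toFin y y<)) }
  agrees : ∀ {g} → (∀ x → x < suc M → s x ≡ g x) → ∀ i → ρ i ≡ liftFin g i
  agrees {g} s≗g i = toℕ-injective {j = toFin {M} (g (toℕ i))}
    (trans ρi≡gi (sym (toℕ-toFin {M} (g (toℕ i)) (subst (_< suc M) ρi≡gi (toℕ<n (ρ i))))))
    where
    ρi≡gi : toℕ (ρ i) ≡ g (toℕ i)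
    ρi≡gi = trans (cong (λ j → toℕ (ρ j)) (sym (toFin-toℕ i))) (s≗g (toℕ i) (toℕ<n i))

Joined : Parent → ℕ → ℕ → Set
Joined p x y = linked p x y ≡ true

PathLike : Parent → ℕ → Set
PathLike p r = ∀ v w → r ≤ v → Joined p v w → (w ≡ suc v) ⊎ (suc w ≡ v)

PathLikeAbove : Parent → ℕ → Set
PathLikeAbove p r = ∀ v w → r ≤ v → Joined p v w → (w ≡ suc v) ⊎ ((suc w ≡ v) × (r ≤ w))

PathFrom : Parent → ℕ → ℕ → Set
PathFrom p L c = ∀ d → suc (d + c) < suc L → Joined p (d + c) (suc (d + c))

joined-sym : ∀ {p x y} → Joined p x y → Joined p y x
joined-sym {p} {x} {y} joined = trans (linked-sym p y x) joined

path-from-suc : ∀ {p L c} → PathFrom p L c → PathFrom p L (suc c)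
path-from-suc {p} {L} {c} path d = subst (λ x → suc x < suc L → Joined p x (suc x)) (sym (+-suc d c)) (path (suc d))

FixesFrom ReversesFrom : ℕ → (ℕ → ℕ) → ℕ → Set
FixesFrom    L s a = ∀ x → a ≤ x → x < suc L → s x ≡ x
ReversesFrom L s a = ∀ x → a ≤ x → x < suc L → s x ≡ L ∸ (x ∸ a)

module Rigidity (p : Parent) (L : ℕ) (s : ℕ → ℕ) (s-aut : IsAutℕ p (suc L) s) where
  open IsAutℕ s-aut

  joined-preserved : ∀ x y → x < suc L → y < suc L → Joined p x y → Joined p (s x) (s y)
  joined-preserved x y x< y< joined = trans (preserves x y x< y<) joined

  from-offsets : ∀ (P : ℕ → Set) a → (∀ d → d + a < suc L → P (d + a)) →
    ∀ x → a ≤ x → x < suc L → P x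
  from-offsets P a h x a≤x x≤L =
    subst P (m∸n+n≡m a≤x) (h (x ∸ a) (subst (_< suc L) (sym (m∸n+n≡m a≤x)) x≤L))

  -- If s moves the edge c — c+1 of the path to y — y+1 (in a path-like region),
  -- then s translates the whole path c, c+1, … by y − c: the image of the next
  -- vertex is a neighbour of s (c + d + 1) different from s (c + d).
  propagate-up : ∀ r c y → PathLike p r → PathFrom p L c → r ≤ suc y →
    s c ≡ y → s (suc c) ≡ suc y → ∀ d → d + c < suc L → s (d + c) ≡ d + y
  propagate-up r c y path-like path r≤ sc sc+1 = translated
    where
    step : ∀ d → suc (d + c) < suc L →
      (s (d + c) ≡ d + y) × (s (suc (d + c)) ≡ suc (d + y))
    step zero    _ = sc , sc+1
    step (suc d) lt with step d (<-trans (n<1+n _) lt)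
    ... | (h0 , h1) with path-like (s (suc (d + c))) (s (suc (suc (d + c))))
           (subst (r ≤_) (sym h1) (≤-trans r≤ (s≤s (m≤n+m y d))))
           (joined-preserved _ _ (<-trans (n<1+n _) lt) lt (path (suc d) lt))
    ... | inj₁ up   = h1 , trans up (cong suc h1)
    ... | inj₂ down = ⊥-elim (2+n≢n (d + c) (injective _ _ lt (<-trans (n<1+n _) (<-trans (n<1+n _) lt))
                        (trans (suc-injective (trans down h1)) (sym h0))))
    translated : ∀ d → d + c < suc L → s (d + c) ≡ d + y
    translated zero    _  = sc
    translated (suc d) lt = proj₂ (step d lt)

  fixes-tail : ∀ c → PathLike p (suc c) → PathFrom p L c → s c ≡ c → s (suc c) ≡ suc c → FixesFrom L s c
  fixes-tail c path-like path sc sc+1 =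
    from-offsets (λ x → s x ≡ x) c (propagate-up (suc c) c c path-like path ≤-refl sc sc+1)

  propagate-down : ∀ r c y' → PathLikeAbove p r → PathFrom p L c →
    s c ≡ suc y' → s (suc c) ≡ y' → r ≤ y' →
    ∀ d → suc (d + c) < suc L →
    (s (d + c) + d ≡ suc y') × (s (suc (d + c)) + d ≡ y') × (r ≤ s (suc (d + c)))
  propagate-down r c y' path-like path sc sc+1 r≤ = reflected
    where
    reflected : ∀ d → suc (d + c) < suc L →
      (s (d + c) + d ≡ suc y') × (s (suc (d + c)) + d ≡ y') × (r ≤ s (suc (d + c)))
    reflected zero    _ = trans (+-identityʳ _) sc , trans (+-identityʳ _) sc+1 , subst (r ≤_) (sym sc+1) r≤
    reflected (suc d) lt with reflected d (<-trans (n<1+n _) lt)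
    ... | (h0 , h1 , hr) with path-like (s (suc (d + c))) (s (suc (suc (d + c)))) hr
           (joined-preserved _ _ (<-trans (n<1+n _) lt) lt (path (suc d) lt))
    ... | inj₁ up = ⊥-elim (2+n≢n (d + c) (injective _ _ lt (<-trans (n<1+n _) (<-trans (n<1+n _) lt))
                      (trans up (sym (+-cancelʳ-≡ d _ _ (trans h0 (sym (cong suc h1))))))))
    ... | inj₂ (down , r≤w) = trans (+-suc _ d) (cong suc h1) ,
                              trans (+-suc _ d) (trans (cong (_+ d) down) h1) , r≤w

  first-edge : ∀ a → a < L → PathFrom p L a → Joined p (s a) (s (suc a))
  first-edge a a<L path = joined-preserved _ _ (<-trans (n<1+n a) (s≤s a<L)) (s≤s a<L) (path 0 (s≤s a<L))

  -- If s maps a — a+1 to y — y+1 with a ≤ y, then s fixes the path a, …, L: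
  -- by `propagate-up`, s L = (L − a) + s a, which is ≤ L only if s a = a.
  fixed-if-rising : ∀ a → a < L → PathLike p a → PathFrom p L a →
    a ≤ s a → s (suc a) ≡ suc (s a) → FixesFrom L s a
  fixed-if-rising a a<L path-like path a≤sa up =
    from-offsets (λ x → s x ≡ x) a λ d lt → trans (translated d lt) (cong (d +_) sa≡a)
    where
    translated : ∀ d → d + a < suc L → s (d + a) ≡ d + s a
    translated = propagate-up a a (s a) path-like path (≤-trans a≤sa (n≤1+n _)) refl up
    D : ℕ
    D = L ∸ a
    D+a≡L : D + a ≡ L
    D+a≡L = m∸n+n≡m (<⇒≤ a<L)
    sa≡a : s a ≡ a
    sa≡a = ≤-antisym (+-cancelˡ-≤ D _ _ (subst (D + s a ≤_) (sym D+a≡L)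
      (≤-pred (subst (_< suc L) (translated D (s≤s (≤-reflexive D+a≡L)))
        (bounded _ (s≤s (≤-reflexive D+a≡L)))))))
      a≤sa

  -- If s maps a — a+1 to y+1 — y with a ≤ y, then s reverses the path a, …, L:
  -- by `propagate-down`, s L = s a − (L − a), which is ≥ a only if s a = L.
  reversed-if-falling : ∀ a → a < L → PathLikeAbove p a → PathFrom p L a →
    s a ≡ suc (s (suc a)) → a ≤ s (suc a) → ReversesFrom L s a
  reversed-if-falling a a<L path-like path sa a≤sa+1 x a≤x x≤L =
    trans (sym (m+n∸n≡m (s x) (x ∸ a))) (cong (_∸ (x ∸ a))
      (from-offsets (λ z → s z + (z ∸ a) ≡ L) a
        (λ d lt → trans (cong (s (d + a) +_) (m+n∸n≡m d a)) (offsets d lt)) x a≤x x≤L))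
    where
    reflected : ∀ d → suc (d + a) < suc L → (s (d + a) + d ≡ suc (s (suc a))) ×
      (s (suc (d + a)) + d ≡ s (suc a)) × (a ≤ s (suc (d + a)))
    reflected = propagate-down a a (s (suc a)) path-like path sa refl a≤sa+1
    D : ℕ
    D = L ∸ suc a
    1+D+a≡L : suc (D + a) ≡ L
    1+D+a≡L = trans (sym (+-suc D a)) (m∸n+n≡m a<L)
    sa≡L : s a ≡ L
    sa≡L with reflected D (s≤s (≤-reflexive 1+D+a≡L))
    ... | (_ , h1 , hr) = ≤-antisym (≤-pred (bounded a (<-trans (n<1+n a) (s≤s a<L))))
          (subst (_≤ s a) (trans (cong suc (+-comm a D)) 1+D+a≡L)
            (subst (suc (a + D) ≤_) (sym sa) (s≤s (subst (a + D ≤_) h1 (+-monoˡ-≤ D hr)))))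
    offsets : ∀ d → d + a < suc L → s (d + a) + d ≡ L
    offsets zero    _  = trans (+-identityʳ _) sa≡L
    offsets (suc d) lt with reflected d lt
    ... | (_ , h1 , _) = trans (+-suc _ d) (trans (cong suc h1) (trans (sym sa) sa≡L))

  -- A path a, a+1, …, L, all of whose vertices below a are isolated, is either
  -- fixed or reversed: s a is not isolated, so a ≤ s a, and s (a+1) = s a ± 1.
  tail-fixed-or-reversed : ∀ a → a < L →
    (∀ v w → v < a → linked p v w ≡ false) → PathLikeAbove p a → PathFrom p L a →
    FixesFrom L s a ⊎ ReversesFrom L s a
  tail-fixed-or-reversed a a<L isolated path-like path with a ≤? s a
  ... | no a≰sa =
    ⊥-elim (false≢true (trans (sym (isolated (s a) (s (suc a)) (≰⇒> a≰sa))) (first-edge a a<L path)))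
  ... | yes a≤sa with path-like (s a) (s (suc a)) a≤sa (first-edge a a<L path)
  ... | inj₁ up            = inj₁ (fixed-if-rising a a<L path-like′ path a≤sa up)
    where
    path-like′ : PathLike p a
    path-like′ v w a≤v joined = Sum.map₂ proj₁ (path-like v w a≤v joined)
  ... | inj₂ (down , a≤w)  = inj₂ (reversed-if-falling a a<L path-like path (sym down) a≤w)

  tail-onto : ∀ a → FixesFrom L s a ⊎ ReversesFrom L s a →
    ∀ y → a ≤ y → y < suc L → Σ ℕ λ x → (a ≤ x) × (x < suc L) × (s x ≡ y)
  tail-onto a (inj₁ fixes)    y a≤y y≤L = y , a≤y , y≤L , fixes y a≤y y≤L
  tail-onto a (inj₂ reverses) y a≤y y≤L = a + (L ∸ y) , m≤m+n a _ , x≤L ,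
    trans (reverses _ (m≤m+n a _) x≤L)
      (trans (cong (L ∸_) (m+n∸m≡n a (L ∸ y))) (m∸[m∸n]≡n (≤-pred y≤L)))
    where
    x≤L : a + (L ∸ y) < suc L
    x≤L = s≤s (subst (a + (L ∸ y) ≤_) (m+[n∸m]≡n (≤-pred y≤L)) (+-monoˡ-≤ (L ∸ y) a≤y))

BranchAt : Parent → ℕ → Set
BranchAt p v = Σ ℕ λ x → Σ ℕ λ y → Σ ℕ λ z → (x ≢ y) × (x ≢ z) × (y ≢ z) ×
  Joined p v x × Joined p v y × Joined p v z

no-three-in-two : ∀ {A : Set} {x y u v w : A} →
  (u ≡ x ⊎ u ≡ y) → (v ≡ x ⊎ v ≡ y) → (w ≡ x ⊎ w ≡ y) →
  u ≢ v → u ≢ w → v ≢ w → ⊥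
no-three-in-two (inj₁ refl) (inj₁ refl) _           u≢v _   _   = u≢v refl
no-three-in-two (inj₁ refl) (inj₂ refl) (inj₁ refl) _   u≢w _   = u≢w refl
no-three-in-two (inj₁ refl) (inj₂ refl) (inj₂ refl) _   _   v≢w = v≢w refl
no-three-in-two (inj₂ refl) (inj₁ refl) (inj₁ refl) _   _   v≢w = v≢w refl
no-three-in-two (inj₂ refl) (inj₁ refl) (inj₂ refl) _   u≢w _   = u≢w refl
no-three-in-two (inj₂ refl) (inj₂ refl) _           u≢v _   _   = u≢v refl

at-most-two : ∀ {p v} x y → (∀ w → Joined p v w → w ≡ x ⊎ w ≡ y) → ¬ BranchAt p v
at-most-two x y within (u , v , w , u≢v , u≢w , v≢w , ju , jv , jw) =
  no-three-in-two (within u ju) (within v jv) (within w jw) u≢v u≢w v≢w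

succ-pred-only : ∀ {p v} → (∀ w → Joined p v w → w ≡ suc v ⊎ suc w ≡ v) → ¬ BranchAt p v
succ-pred-only {p} {v} nbrs = at-most-two {p} {v} (suc v) (pred v) λ w joined →
  Sum.map₂ (cong pred) (nbrs w joined)

module Named (p : Parent) (L : ℕ) (s : ℕ → ℕ) (s-aut : IsAutℕ p (suc L) s)
             (a B : ℕ) (room : B + a < suc L) where

  vertex : ∀ c {c≤B : True (c ≤? B)} → c + a < suc L
  vertex c {c≤B} = ≤-<-trans (+-monoˡ-≤ a (toWitness c≤B)) room

  apart : ∀ c d {c≤B : True (c ≤? B)} {d≤B : True (d ≤? B)} → c ≢ d → s (c + a) ≢ s (d + a)
  apart c d {c≤B} {d≤B} c≢d =
    images-distinct s-aut (vertex c {c≤B}) (vertex d {d≤B}) (λ eq → c≢d (+-cancelʳ-≡ a c d eq))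

  maps : ∀ c d {c≤B : True (c ≤? B)} {d≤B : True (d ≤? B)} →
    Joined p (c + a) (d + a) → Joined p (s (c + a)) (s (d + a))
  maps c d {c≤B} {d≤B} joined =
    trans (IsAutℕ.preserves s-aut _ _ (vertex c {c≤B}) (vertex d {d≤B})) joined

  maps-from : ∀ c d {c≤B : True (c ≤? B)} {d≤B : True (d ≤? B)} {v} → s (c + a) ≡ v →
    Joined p (c + a) (d + a) → Joined p v (s (d + a))
  maps-from c d {c≤B} {d≤B} refl = maps c d {c≤B} {d≤B}

-- Vertices 0, …, a − 1 isolated, followed by the path a — a+1 — a+2 — ⋯
dotsPath : ℕ → Parent
dotsPath a v = if a ≤ᵇ v then just (suc v) else nothing

dotsPath-parent : ∀ a v w → dotsPath a v ≡ just w → (w ≡ suc v) × (a ≤ v)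
dotsPath-parent a v w eq with a ≤ᵇ v in a≤ᵇv
... | true = sym (just-injective eq) , ≤ᵇ⇒≤ a v (subst T (sym a≤ᵇv) _)

dotsPath-above : ∀ {a v} → a ≤ v → dotsPath a v ≡ just (suc v)
dotsPath-above a≤v rewrite T⇒≡true (≤⇒≤ᵇ a≤v) = refl

dotsPath-increasing : ∀ a → Increasing (dotsPath a)
dotsPath-increasing a v w eq = subst (v <_) (sym (proj₁ (dotsPath-parent a v w eq))) (n<1+n v)

dotsPath-joined : ∀ a v w → Joined (dotsPath a) v w →
  ((w ≡ suc v) × (a ≤ v)) ⊎ ((suc w ≡ v) × (a ≤ w))
dotsPath-joined a v w joined with linked-sound _ v w joined
... | inj₁ up   = inj₁ (dotsPath-parent a v w up)
... | inj₂ down = inj₂ (sym (proj₁ (dotsPath-parent a w v down)) , proj₂ (dotsPath-parent a w v down))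

dotsPath-isolated : ∀ a v w → v < a → linked (dotsPath a) v w ≡ false
dotsPath-isolated a v w v<a with linked (dotsPath a) v w in joined
... | false = refl
... | true with dotsPath-joined a v w joined
...   | inj₁ (_ , a≤v)     = ⊥-elim (<⇒≱ v<a a≤v)
...   | inj₂ (1+w≡v , a≤w) = ⊥-elim (<⇒≱ v<a (≤-trans a≤w (subst (w ≤_) 1+w≡v (n≤1+n w))))

dotsPath-pathLike : ∀ a → PathLikeAbove (dotsPath a) a
dotsPath-pathLike a v w _ joined with dotsPath-joined a v w joined
... | inj₁ (up , _) = inj₁ up
... | inj₂ down     = inj₂ down

dotsPath-path : ∀ a L → PathFrom (dotsPath a) L a
dotsPath-path a L d _ = linked-up (dotsPath a) _ _ (dotsPath-above (m≤n+m a d))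

dotsPath-automorphisms : ∀ a L → a < L → ∀ s → IsAutℕ (dotsPath a) (suc L) s →
  (FixesFrom L s a ⊎ ReversesFrom L s a) × (∀ v → v < a → s v < a)
dotsPath-automorphisms a L a<L s s-aut = tail , low-stays-low s-aut a (<⇒≤ a<L) (tail-onto a tail)
  where
  open Rigidity (dotsPath a) L s s-aut
  tail : FixesFrom L s a ⊎ ReversesFrom L s a
  tail = tail-fixed-or-reversed a a<L (dotsPath-isolated a) (dotsPath-pathLike a) (dotsPath-path a L)

glue : ℕ → ℕ → (ℕ → ℕ) → ℕ → ℕ
glue x₀ x₁ t zero          = x₀
glue x₀ x₁ t (suc zero)    = x₁
glue x₀ x₁ t (suc (suc x)) = t (suc (suc x))

agrees-glue : ∀ {N} (s : ℕ → ℕ) x₀ x₁ t → s 0 ≡ x₀ → s 1 ≡ x₁ →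
  (∀ x → 2 ≤ x → x < N → s x ≡ t x) → ∀ x → x < N → s x ≡ glue x₀ x₁ t x
agrees-glue s x₀ x₁ t s0 s1 tail zero          _  = s0
agrees-glue s x₀ x₁ t s0 s1 tail (suc zero)    _  = s1
agrees-glue s x₀ x₁ t s0 s1 tail (suc (suc x)) lt = tail (suc (suc x)) (s≤s (s≤s z≤n)) lt

path-auts : ℕ → List (ℕ → ℕ)
path-auts L = (λ x → x) ∷ (L ∸_) ∷ []

path-lists : ∀ L → 1 ≤ L → ListsAutℕ (dotsPath 0) (suc L) (path-auts L)
path-lists L 1≤L s s-aut with dotsPath-automorphisms 0 L 1≤L s s-aut
... | inj₁ fixes    , _ = here λ x x≤L → fixes x z≤n x≤L
... | inj₂ reverses , _ = there (here λ x x≤L → reverses x z≤n x≤L)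

dotPath-auts : ℕ → List (ℕ → ℕ)
dotPath-auts L = glue 0 1 (λ x → x) ∷ glue 0 L (λ x → L ∸ (x ∸ 1)) ∷ []

dotPath-lists : ∀ L → 2 ≤ L → ListsAutℕ (dotsPath 1) (suc L) (dotPath-auts L)
dotPath-lists L 2≤L s s-aut with proj₁ shape | n<1⇒n≡0 (proj₂ shape 0 ≤-refl)
  where
  shape : (FixesFrom L s 1 ⊎ ReversesFrom L s 1) × (∀ v → v < 1 → s v < 1)
  shape = dotsPath-automorphisms 1 L 2≤L s s-aut
... | inj₁ fixes    | s0≡0 =
  here (agrees-glue s _ _ _ s0≡0 (fixes 1 ≤-refl (s≤s (≤-trans (n≤1+n 1) 2≤L)))
    (λ x 2≤x → fixes x (≤-trans (n≤1+n 1) 2≤x)))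
... | inj₂ reverses | s0≡0 =
  there (here (agrees-glue s _ _ _ s0≡0 (reverses 1 ≤-refl (s≤s (≤-trans (n≤1+n 1) 2≤L)))
    (λ x 2≤x → reverses x (≤-trans (n≤1+n 1) 2≤x))))

two-values : ∀ {A : Set} {x y u v : A} → (u ≡ x ⊎ u ≡ y) → (v ≡ x ⊎ v ≡ y) → u ≢ v →
  ((u ≡ x) × (v ≡ y)) ⊎ ((u ≡ y) × (v ≡ x))
two-values (inj₁ refl) (inj₁ refl) u≢v = ⊥-elim (u≢v refl)
two-values (inj₁ u≡x)  (inj₂ v≡y)  _   = inj₁ (u≡x , v≡y)
two-values (inj₂ u≡y)  (inj₁ v≡x)  _   = inj₂ (u≡y , v≡x)
two-values (inj₂ refl) (inj₂ refl) u≢v = ⊥-elim (u≢v refl)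

below-2 : ∀ {x} → x < 2 → x ≡ 0 ⊎ x ≡ 1
below-2 (s≤s z≤n)       = inj₁ refl
below-2 (s≤s (s≤s z≤n)) = inj₂ refl

twoDotsPath-auts : ℕ → List (ℕ → ℕ)
twoDotsPath-auts L =
  glue 0 1 (λ x → x) ∷ glue 1 0 (λ x → x) ∷
  glue 0 1 (λ x → L ∸ (x ∸ 2)) ∷ glue 1 0 (λ x → L ∸ (x ∸ 2)) ∷ []

twoDotsPath-lists : ∀ L → 3 ≤ L → ListsAutℕ (dotsPath 2) (suc L) (twoDotsPath-auts L)
twoDotsPath-lists L 3≤L s s-aut
  with proj₁ shape
     | two-values (below-2 (proj₂ shape 0 (s≤s z≤n))) (below-2 (proj₂ shape 1 ≤-refl))
                  (images-distinct s-aut (s≤s z≤n) 1≤L (λ ()))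
  where
  shape : (FixesFrom L s 2 ⊎ ReversesFrom L s 2) × (∀ v → v < 2 → s v < 2)
  shape = dotsPath-automorphisms 2 L 3≤L s s-aut
  1≤L : 1 < suc L
  1≤L = s≤s (≤-trans (n≤1+n 1) (≤-trans (n≤1+n 2) 3≤L))
... | inj₁ fixes    | inj₁ (s0 , s1) = here (agrees-glue s _ _ _ s0 s1 fixes)
... | inj₁ fixes    | inj₂ (s0 , s1) = there (here (agrees-glue s _ _ _ s0 s1 fixes))
... | inj₂ reverses | inj₁ (s0 , s1) = there (there (here (agrees-glue s _ _ _ s0 s1 reverses)))
... | inj₂ reverses | inj₂ (s0 , s1) = there (there (there (here (agrees-glue s _ _ _ s0 s1 reverses))))

-- Vertices 0, …, a − 1 isolated, the path a + 1 — a + 2 — ⋯, and the leaf a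
-- hanging at the vertex h of the path (a + 2 ≤ h).
pendantAt : ℕ → ℕ → Parent
pendantAt a h v with <-cmp v a
... | tri< _ _ _ = nothing
... | tri≈ _ _ _ = just h
... | tri> _ _ _ = just (suc v)

module _ (a h : ℕ) where

  private
    P : Parent
    P = pendantAt a h

  pendant-parent : ∀ v w → P v ≡ just w → ((v ≡ a) × (w ≡ h)) ⊎ ((w ≡ suc v) × (a < v))
  pendant-parent v w eq with <-cmp v a
  ... | tri≈ _ v≡a _ = inj₁ (v≡a , sym (just-injective eq))
  ... | tri> _ _ a<v = inj₂ (sym (just-injective eq) , a<v)

  pendant-at : P a ≡ just h
  pendant-at with <-cmp a a
  ... | tri< a<a _ _ = ⊥-elim (<-irrefl refl a<a)
  ... | tri≈ _ _ _   = refl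
  ... | tri> _ _ a<a = ⊥-elim (<-irrefl refl a<a)

  pendant-above : ∀ {v} → a < v → P v ≡ just (suc v)
  pendant-above {v} a<v with <-cmp v a
  ... | tri< v<a _ _ = ⊥-elim (<-asym a<v v<a)
  ... | tri≈ _ v≡a _ = ⊥-elim (<-irrefl (sym v≡a) a<v)
  ... | tri> _ _ _   = refl

  pendant-path : ∀ L → PathFrom P L (suc a)
  pendant-path L d _ = linked-up P _ _ (pendant-above (m≤n+m (suc a) d))

  pendant-joined : ∀ v w → Joined P v w →
    ((v ≡ a) × (w ≡ h)) ⊎ ((w ≡ suc v) × (a < v)) ⊎ ((w ≡ a) × (v ≡ h)) ⊎ ((v ≡ suc w) × (a < w))
  pendant-joined v w joined with linked-sound P v w joined
  ... | inj₁ up with pendant-parent v w up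
  ...   | inj₁ e = inj₁ e
  ...   | inj₂ e = inj₂ (inj₁ e)
  pendant-joined v w joined | inj₂ down with pendant-parent w v down
  ...   | inj₁ (w≡a , v≡h)   = inj₂ (inj₂ (inj₁ (w≡a , v≡h)))
  ...   | inj₂ (v≡1+w , a<w) = inj₂ (inj₂ (inj₂ (v≡1+w , a<w)))

  module _ (2+a≤h : 2 + a ≤ h) where

    private
      a<h : a < h
      a<h = ≤-trans (n≤1+n _) 2+a≤h
      above-pred : ∀ {v w} → v ≡ suc w → a < w → a < v
      above-pred refl a<w = <-trans a<w (n<1+n _)

    pendant-increasing : Increasing P
    pendant-increasing v w eq with pendant-parent v w eq
    ... | inj₁ (refl , refl) = a<h
    ... | inj₂ (refl , _)    = n<1+n v

    pendant-leaf : ∀ w → Joined P a w → w ≡ h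
    pendant-leaf w joined with pendant-joined a w joined
    ... | inj₁ (_ , w≡h)                  = w≡h
    ... | inj₂ (inj₁ (_ , a<a))           = ⊥-elim (<-irrefl refl a<a)
    ... | inj₂ (inj₂ (inj₁ (_ , a≡h)))    = ⊥-elim (<-irrefl a≡h a<h)
    ... | inj₂ (inj₂ (inj₂ (a≡1+w , a<w))) = ⊥-elim (<-irrefl refl (above-pred a≡1+w a<w))

    pendant-start : ∀ w → Joined P (1 + a) w → w ≡ 2 + a
    pendant-start w joined with pendant-joined (1 + a) w joined
    ... | inj₁ (1+a≡a , _)                = ⊥-elim (1+n≢n 1+a≡a)
    ... | inj₂ (inj₁ (w≡2+a , _))         = w≡2+a
    ... | inj₂ (inj₂ (inj₁ (_ , 1+a≡h)))  = ⊥-elim (<-irrefl 1+a≡h 2+a≤h)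
    ... | inj₂ (inj₂ (inj₂ (refl , a<a))) = ⊥-elim (<-irrefl refl a<a)

    pendant-hub : ∀ w → Joined P h w → (w ≡ a ⊎ w ≡ pred h) ⊎ w ≡ suc h
    pendant-hub w joined with pendant-joined h w joined
    ... | inj₁ (h≡a , _)                  = ⊥-elim (<-irrefl (sym h≡a) a<h)
    ... | inj₂ (inj₁ (w≡1+h , _))         = inj₂ w≡1+h
    ... | inj₂ (inj₂ (inj₁ (w≡a , _)))    = inj₁ (inj₁ w≡a)
    ... | inj₂ (inj₂ (inj₂ (h≡1+w , _)))  = inj₁ (inj₂ (sym (cong pred h≡1+w)))

    pendant-pathLike : ∀ v w → v ≢ a → v ≢ h → Joined P v w → w ≡ suc v ⊎ suc w ≡ v
    pendant-pathLike v w v≢a v≢h joined with pendant-joined v w joined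
    ... | inj₁ (v≡a , _)                 = ⊥-elim (v≢a v≡a)
    ... | inj₂ (inj₁ (w≡1+v , _))        = inj₁ w≡1+v
    ... | inj₂ (inj₂ (inj₁ (_ , v≡h)))   = ⊥-elim (v≢h v≡h)
    ... | inj₂ (inj₂ (inj₂ (v≡1+w , _))) = inj₂ (sym v≡1+w)

    pendant-isolated : ∀ v w → v < a → linked P v w ≡ false
    pendant-isolated v w v<a with linked P v w in joined
    ... | false = refl
    ... | true with pendant-joined v w joined
    ...   | inj₁ (v≡a , _)                   = ⊥-elim (<-irrefl v≡a v<a)
    ...   | inj₂ (inj₁ (_ , a<v))            = ⊥-elim (<-asym a<v v<a)
    ...   | inj₂ (inj₂ (inj₁ (_ , v≡h)))     = ⊥-elim (<-asym v<a (subst (a <_) (sym v≡h) a<h))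
    ...   | inj₂ (inj₂ (inj₂ (v≡1+w , a<w))) = ⊥-elim (<-asym (above-pred v≡1+w a<w) v<a)

    pendant-only-branch : ∀ v → BranchAt P v → v ≡ h
    pendant-only-branch v branch = decide (v ≟ h) (v ≟ a)
      where
      decide : Dec (v ≡ h) → Dec (v ≡ a) → v ≡ h
      decide (yes v≡h) _         = v≡h
      decide (no  v≢h) (yes v≡a) = ⊥-elim (at-most-two {p = P} h h
        (λ w joined → inj₁ (pendant-leaf w (subst (λ u → Joined P u w) v≡a joined))) branch)
      decide (no  v≢h) (no  v≢a) =
        ⊥-elim (succ-pred-only {p = P} (λ w → pendant-pathLike v w v≢a v≢h) branch)

-- The fork: the leaves a and a + 1 both hang at the hub a + 2.
forkAt : ℕ → Parent
forkAt a = pendantAt a (2 + a)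

fork-increasing : ∀ a → Increasing (forkAt a)
fork-increasing a = pendant-increasing a (2 + a) ≤-refl

fork-leaf-edge₀ : ∀ a → Joined (forkAt a) (2 + a) a
fork-leaf-edge₀ a = joined-sym {forkAt a} {a} (linked-up (forkAt a) a (2 + a) (pendant-at a (2 + a)))

fork-leaf-edge₁ : ∀ a → Joined (forkAt a) (2 + a) (1 + a)
fork-leaf-edge₁ a = joined-sym {forkAt a} {1 + a}
  (linked-up (forkAt a) (1 + a) (2 + a) (pendant-above a (2 + a) (n<1+n a)))

LeavesPermuted : (ℕ → ℕ) → ℕ → Set
LeavesPermuted s a = ((s a ≡ a) × (s (1 + a) ≡ 1 + a)) ⊎ ((s a ≡ 1 + a) × (s (1 + a) ≡ a))

module ForkAutomorphisms (a L : ℕ) (room : 4 + a < suc L) (s : ℕ → ℕ)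
                         (s-aut : IsAutℕ (forkAt a) (suc L) s) where
  F : Parent
  F = forkAt a
  open Rigidity F L s s-aut
  open Named F L s s-aut a 4 room

  hub-edge : Joined F (2 + a) (3 + a)
  hub-edge = pendant-path a (2 + a) L 1 (vertex 3)
  next-edge : Joined F (3 + a) (4 + a)
  next-edge = pendant-path a (2 + a) L 2 (vertex 4)

  -- the hub is the only branch vertex, so it is fixed
  s-hub : s (2 + a) ≡ 2 + a
  s-hub = pendant-only-branch a (2 + a) ≤-refl (s (2 + a)) (s a , s (1 + a) , s (3 + a) ,
    apart 0 1 (λ ()) , apart 0 3 (λ ()) , apart 1 3 (λ ()) ,
    maps 2 0 (fork-leaf-edge₀ a) , maps 2 1 (fork-leaf-edge₁ a) , maps 2 3 hub-edge)

  at-hub : ∀ c {c≤4 : True (c ≤? 4)} → Joined F (2 + a) (c + a) →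
    (s (c + a) ≡ a ⊎ s (c + a) ≡ 1 + a) ⊎ s (c + a) ≡ 3 + a
  at-hub c {c≤4} joined = pendant-hub a (2 + a) ≤-refl _ (maps-from 2 c {_} {c≤4} s-hub joined)

  -- 3 + a is not mapped to a leaf: its neighbour 4 + a would be mapped to the hub
  s-next : s (3 + a) ≡ 3 + a
  s-next with at-hub 3 hub-edge
  ... | inj₂ e        = e
  ... | inj₁ (inj₁ e) = ⊥-elim (apart 4 2 (λ ()) (trans (pendant-leaf a (2 + a) ≤-refl _
          (maps-from 3 4 e next-edge)) (sym s-hub)))
  ... | inj₁ (inj₂ e) = ⊥-elim (apart 4 2 (λ ()) (trans (pendant-start a (2 + a) ≤-refl _
          (maps-from 3 4 e next-edge)) (sym s-hub)))

  fixes : FixesFrom L s (2 + a)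
  fixes = fixes-tail (2 + a) path-like path s-hub s-next
    where
    path : PathFrom F L (2 + a)
    path = path-from-suc (pendant-path a (2 + a) L)
    path-like : PathLike F (3 + a)
    path-like v w 3+a≤v = pendant-pathLike a (2 + a) ≤-refl v w
      (λ v≡a → <-irrefl (sym v≡a) (≤-trans (m≤n+m (suc a) 2) 3+a≤v))
      (λ v≡2+a → <-irrefl (sym v≡2+a) 3+a≤v)

  leaf-image : ∀ c {c≤4 : True (c ≤? 4)} → Joined F (2 + a) (c + a) → c ≢ 3 →
    s (c + a) ≡ a ⊎ s (c + a) ≡ 1 + a
  leaf-image c {c≤4} joined c≢3 with at-hub c {c≤4} joined
  ... | inj₁ leaf = leaf
  ... | inj₂ e    = ⊥-elim (apart c 3 {c≤4} c≢3 (trans e (sym s-next)))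

  leaves : LeavesPermuted s a
  leaves = two-values (leaf-image 0 (fork-leaf-edge₀ a) (λ ())) (leaf-image 1 (fork-leaf-edge₁ a) (λ ()))
    (apart 0 1 (λ ()))

  a≤L : a ≤ L
  a≤L = ≤-pred (vertex 0)

  onto : ∀ y → a ≤ y → y < suc L → Σ ℕ λ x → (a ≤ x) × (x < suc L) × (s x ≡ y)
  onto y a≤y y≤L with y ≟ a | y ≟ 1 + a | leaves
  ... | yes y≡a | _          | inj₁ (s0 , _) = a , ≤-refl , vertex 0 , trans s0 (sym y≡a)
  ... | yes y≡a | _          | inj₂ (_ , s1) = 1 + a , n≤1+n a , vertex 1 , trans s1 (sym y≡a)
  ... | no _    | yes y≡1+a  | inj₁ (_ , s1) = 1 + a , n≤1+n a , vertex 1 , trans s1 (sym y≡1+a)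
  ... | no _    | yes y≡1+a  | inj₂ (s0 , _) = a , ≤-refl , vertex 0 , trans s0 (sym y≡1+a)
  ... | no y≢a  | no y≢1+a   | _ = y , a≤y , y≤L , fixes y 2+a≤y y≤L
    where
    2+a≤y : 2 + a ≤ y
    2+a≤y = ≤∧≢⇒< (≤∧≢⇒< a≤y (λ a≡y → y≢a (sym a≡y))) (λ 1+a≡y → y≢1+a (sym 1+a≡y))

fork-automorphisms : ∀ a L → 4 + a < suc L → ∀ s → IsAutℕ (forkAt a) (suc L) s →
  FixesFrom L s (2 + a) × LeavesPermuted s a × (∀ v → v < a → s v < a)
fork-automorphisms a L room s s-aut = fixes , leaves , low-stays-low s-aut a a≤L onto
  where open ForkAutomorphisms a L room s s-aut

fork-auts : List (ℕ → ℕ)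
fork-auts = glue 0 1 (λ x → x) ∷ glue 1 0 (λ x → x) ∷ []

fork-lists : ∀ L → 4 ≤ L → ListsAutℕ (forkAt 0) (suc L) fork-auts
fork-lists L 4≤L s s-aut with fork-automorphisms 0 L (s≤s 4≤L) s s-aut
... | fixes , inj₁ (s0 , s1) , _ = here (agrees-glue s _ _ _ s0 s1 fixes)
... | fixes , inj₂ (s0 , s1) , _ = there (here (agrees-glue s _ _ _ s0 s1 fixes))

swap₁₂ : ℕ → ℕ
swap₁₂ 1 = 2
swap₁₂ 2 = 1
swap₁₂ x = x

dotFork-auts : List (ℕ → ℕ)
dotFork-auts = (λ x → x) ∷ swap₁₂ ∷ []

dotFork-lists : ∀ L → 5 ≤ L → ListsAutℕ (forkAt 1) (suc L) dotFork-auts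
dotFork-lists L 5≤L s s-aut with fork-automorphisms 1 L (s≤s 5≤L) s s-aut
... | fixes , inj₁ (s1 , s2) , low = here λ where
  0                   _  → n<1⇒n≡0 (low 0 ≤-refl)
  1                   _  → s1
  2                   _  → s2
  (suc (suc (suc x))) lt → fixes _ (s≤s (s≤s (s≤s z≤n))) lt
... | fixes , inj₂ (s1 , s2) , low = there (here λ where
  0                   _  → n<1⇒n≡0 (low 0 ≤-refl)
  1                   _  → s1
  2                   _  → s2
  (suc (suc (suc x))) lt → fixes _ (s≤s (s≤s (s≤s z≤n))) lt)

-- The spur: the path 1 — 2 — ⋯ — L with the leaf 0 hanging at 3.
spur : Parent
spur = pendantAt 0 3

-- The reflection of the spider with legs 1, 2, 2 (the spur on six vertices).
mirror : ℕ → ℕ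
mirror 1 = 5
mirror 2 = 4
mirror 4 = 2
mirror 5 = 1
mirror x = x

spur-auts : List (ℕ → ℕ)
spur-auts = (λ x → x) ∷ mirror ∷ []

-- The spur is rigid, except for the reflection `mirror` when L = 5.
module SpurAutomorphisms (L : ℕ) (5≤L : 5 ≤ L) (s : ℕ → ℕ) (s-aut : IsAutℕ spur (suc L) s) where
  open Named spur L s s-aut 0 5 (s≤s 5≤L)
  open Rigidity spur L s s-aut

  2≤3 : 2 ≤ 3
  2≤3 = s≤s (s≤s z≤n)

  edge-1-2 : Joined spur 1 2
  edge-1-2 = pendant-path 0 3 L 0 (vertex 2)
  edge-3-2 : Joined spur 3 2
  edge-3-2 = joined-sym {spur} {2} {3} (pendant-path 0 3 L 1 (vertex 3))
  edge-3-4 : Joined spur 3 4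
  edge-3-4 = pendant-path 0 3 L 2 (vertex 4)
  edge-4-5 : Joined spur 4 5
  edge-4-5 = pendant-path 0 3 L 3 (vertex 5)

  -- 3 is the only branch vertex, so it is fixed
  s3 : s 3 ≡ 3
  s3 = pendant-only-branch 0 3 2≤3 (s 3) (s 0 , s 2 , s 4 ,
    apart 0 2 (λ ()) , apart 0 4 (λ ()) , apart 2 4 (λ ()) ,
    maps 3 0 (joined-sym {spur} {0} {3} (linked-up spur 0 3 refl)) , maps 3 2 edge-3-2 , maps 3 4 edge-3-4)

  at-hub : ∀ c {c≤5 : True (c ≤? 5)} → Joined spur 3 (c + 0) →
    (s (c + 0) ≡ 0 ⊎ s (c + 0) ≡ 2) ⊎ s (c + 0) ≡ 4
  at-hub c {c≤5} joined = pendant-hub 0 3 2≤3 _ (maps-from 3 c {_} {c≤5} s3 joined)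

  -- 2 is not mapped to the leaf 0: its neighbour 1 would be mapped to 3
  s2≢0 : s 2 ≢ 0
  s2≢0 s2≡0 = apart 1 3 (λ ())
    (trans (pendant-leaf 0 3 2≤3 _ (maps-from 2 1 s2≡0 (joined-sym {spur} {1} {2} edge-1-2))) (sym s3))

  -- the neighbours 2 and 4 of the hub are mapped onto {2, 4}, so the leaf 0 is fixed
  leaf-fixed : ∀ {x y} → s 2 ≡ x → s 4 ≡ y → (x ≡ 2 × y ≡ 4) ⊎ (x ≡ 4 × y ≡ 2) → s 0 ≡ 0
  leaf-fixed s2 s4 two-four with at-hub 0 (joined-sym {spur} {0} {3} (linked-up spur 0 3 refl)) | two-four
  ... | inj₁ (inj₁ s0≡0) | _ = s0≡0
  ... | inj₁ (inj₂ s0≡2) | inj₁ (refl , _) = ⊥-elim (apart 0 2 (λ ()) (trans s0≡2 (sym s2)))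
  ... | inj₁ (inj₂ s0≡2) | inj₂ (_ , refl) = ⊥-elim (apart 0 4 (λ ()) (trans s0≡2 (sym s4)))
  ... | inj₂ s0≡4        | inj₁ (_ , refl) = ⊥-elim (apart 0 4 (λ ()) (trans s0≡4 (sym s4)))
  ... | inj₂ s0≡4        | inj₂ (refl , _) = ⊥-elim (apart 0 2 (λ ()) (trans s0≡4 (sym s2)))

  -- if s fixes 4, then s fixes the path from 3 and hence everything
  identity-if : s 4 ≡ 4 → ∀ x → x < suc L → s x ≡ x
  identity-if s4≡4 0 _ = leaf-fixed (identity-if s4≡4 2 (vertex 2)) s4≡4 (inj₁ (refl , refl))
  identity-if s4≡4 1 _ with identity-if s4≡4 2 (vertex 2)
  ... | s2≡2 with pendant-pathLike 0 3 2≤3 2 (s 1) (λ ()) (λ ())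
                    (maps-from 2 1 s2≡2 (joined-sym {spur} {1} {2} edge-1-2))
  ...   | inj₁ s1≡3   = ⊥-elim (apart 1 3 (λ ()) (trans s1≡3 (sym s3)))
  ...   | inj₂ 1+s1≡2 = suc-injective 1+s1≡2
  identity-if s4≡4 2 _ with at-hub 2 edge-3-2
  ... | inj₁ (inj₁ s2≡0) = ⊥-elim (s2≢0 s2≡0)
  ... | inj₁ (inj₂ s2≡2) = s2≡2
  ... | inj₂ s2≡4        = ⊥-elim (apart 2 4 (λ ()) (trans s2≡4 (sym s4≡4)))
  identity-if s4≡4 (suc (suc (suc x))) lt = fixes-tail 3 path-like
    (path-from-suc (path-from-suc (pendant-path 0 3 L))) s3 s4≡4 _ (s≤s (s≤s (s≤s z≤n))) lt
    where
    path-like : PathLike spur 4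
    path-like v w 4≤v = pendant-pathLike 0 3 2≤3 v w
      (λ v≡0 → <-irrefl (sym v≡0) (≤-trans (s≤s z≤n) 4≤v)) (λ v≡3 → <-irrefl (sym v≡3) 4≤v)

  -- if s maps 4 to 2, then s reflects the spider 1 — 2 — 3 — 4 — 5, 0 — 3,
  -- and there is no vertex 6
  mirror-if : s 4 ≡ 2 → ∀ x → x < suc L → s x ≡ mirror x
  mirror-if s4≡2 = reflection
    where
    s5≡1 : s 5 ≡ 1
    s5≡1 with pendant-pathLike 0 3 2≤3 2 (s 5) (λ ()) (λ ()) (maps-from 4 5 s4≡2 edge-4-5)
    ... | inj₁ s5≡3   = ⊥-elim (apart 5 3 (λ ()) (trans s5≡3 (sym s3)))
    ... | inj₂ 1+s5≡2 = suc-injective 1+s5≡2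
    -- a vertex 6 would be mapped to the neighbour 2 = s 4 of s 5 = 1
    no-6 : ¬ (6 < suc L)
    no-6 6≤L = images-distinct s-aut 6≤L (vertex 4) (λ ()) (trans
      (pendant-start 0 3 2≤3 _ (subst (λ v → Joined spur v (s 6)) s5≡1
        (trans (IsAutℕ.preserves s-aut 5 6 (vertex 5) 6≤L) (pendant-path 0 3 L 4 6≤L)))) (sym s4≡2))
    s2≡4 : s 2 ≡ 4
    s2≡4 with at-hub 2 edge-3-2
    ... | inj₁ (inj₁ s2≡0) = ⊥-elim (s2≢0 s2≡0)
    ... | inj₁ (inj₂ s2≡2) = ⊥-elim (apart 2 4 (λ ()) (trans s2≡2 (sym s4≡2)))
    ... | inj₂ s2≡4        = s2≡4
    s1≡5 : s 1 ≡ 5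
    s1≡5 with pendant-pathLike 0 3 2≤3 4 (s 1) (λ ()) (λ ())
                (maps-from 2 1 s2≡4 (joined-sym {spur} {1} {2} edge-1-2))
    ... | inj₁ s1≡5   = s1≡5
    ... | inj₂ 1+s1≡4 = ⊥-elim (apart 1 3 (λ ()) (trans (suc-injective 1+s1≡4) (sym s3)))
    reflection : ∀ x → x < suc L → s x ≡ mirror x
    reflection 0 _ = leaf-fixed s2≡4 s4≡2 (inj₂ (refl , refl))
    reflection 1 _ = s1≡5
    reflection 2 _ = s2≡4
    reflection 3 _ = s3
    reflection 4 _ = s4≡2
    reflection 5 _ = s5≡1
    reflection (suc (suc (suc (suc (suc (suc x)))))) lt =
      ⊥-elim (no-6 (≤-trans (s≤s (s≤s (s≤s (s≤s (s≤s (s≤s (s≤s z≤n))))))) lt))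

  -- s 4 is a neighbour of the hub: 0 is impossible (4 is no leaf), 4 gives the
  -- identity and 2 the reflection
  classify : Any (λ g → ∀ x → x < suc L → s x ≡ g x) spur-auts
  classify with at-hub 4 edge-3-4
  ... | inj₁ (inj₁ s4≡0) =
    ⊥-elim (apart 5 3 (λ ()) (trans (pendant-leaf 0 3 2≤3 _ (maps-from 4 5 s4≡0 edge-4-5)) (sym s3)))
  ... | inj₁ (inj₂ s4≡2) = there (here (mirror-if s4≡2))
  ... | inj₂ s4≡4        = here (identity-if s4≡4)

spur-lists : ∀ L → 5 ≤ L → ListsAutℕ spur (suc L) spur-auts
spur-lists L 5≤L s s-aut = SpurAutomorphisms.classify L 5≤L s s-aut

-- 7. Four isomorphism invariants and the profile they form.

module _ {n : ℕ} (G : Graph n) where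

  Isolated : Fin n → Set
  Isolated i = ∀ j → adj G i j ≡ false

  HangsAt : Fin n → Fin n → Set
  HangsAt x v = ∀ w → adj G x w ≡ true → w ≡ v

  Branch : Fin n → Fin n → Fin n → Fin n → Set
  Branch v x y z = (x ≢ y) × (x ≢ z) × (y ≢ z) ×
    (adj G v x ≡ true) × (adj G v y ≡ true) × (adj G v z ≡ true)

  HasIsolated HasTwoIsolated HasBranch HasCherry : Set
  HasIsolated    = Σ (Fin n) λ i → Isolated i
  HasTwoIsolated = Σ (Fin n) λ i → Σ (Fin n) λ j → (i ≢ j) × Isolated i × Isolated j
  HasBranch      = Σ (Fin n) λ v → Σ (Fin n) λ x → Σ (Fin n) λ y → Σ (Fin n) λ z → Branch v x y z
  HasCherry      = Σ (Fin n) λ v → Σ (Fin n) λ x → Σ (Fin n) λ y → Σ (Fin n) λ z →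
    Branch v x y z × HangsAt x v × HangsAt y v

invariant : ∀ {n} → Fin 4 → Graph n → Set
invariant zero                   = HasIsolated
invariant (suc zero)             = HasTwoIsolated
invariant (suc (suc zero))       = HasBranch
invariant (suc (suc (suc zero))) = HasCherry

isomorphic-sym : ∀ {n} {G H : Graph n} → Isomorphic G H → Isomorphic H G
isomorphic-sym {H = H} (π , π-iso) = flip π , λ i j →
  trans (sym (π-iso (π ⟨$⟩ˡ i) (π ⟨$⟩ˡ j))) (cong₂ (adj H) (inverseʳ π) (inverseʳ π))

invariant-transport : ∀ {n} {G H : Graph n} c → Isomorphic G H → invariant c G → invariant c H
invariant-transport {G = G} {H} c (π , π-iso) = transport c
  where
  f g : _ → _
  f i = π ⟨$⟩ʳ i
  g i = π ⟨$⟩ˡ i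
  f-injective : ∀ {i j} → i ≢ j → f i ≢ f j
  f-injective i≢j eq = i≢j (trans (sym (inverseˡ π)) (trans (cong g eq) (inverseˡ π)))
  adj-at : ∀ i w → adj H (f i) w ≡ adj G i (g w)
  adj-at i w = trans (cong (adj H (f i)) (sym (inverseʳ π))) (π-iso i (g w))
  joined : ∀ {i j} → adj G i j ≡ true → adj H (f i) (f j) ≡ true
  joined {i} {j} e = trans (π-iso i j) e
  isolated : ∀ {i} → Isolated G i → Isolated H (f i)
  isolated {i} iso w = trans (adj-at i w) (iso (g w))
  hangs : ∀ {x v} → HangsAt G x v → HangsAt H (f x) (f v)
  hangs {x} h w e = trans (sym (inverseʳ π)) (cong f (h (g w) (trans (sym (adj-at x w)) e)))
  branch : ∀ {v x y z} → Branch G v x y z → Branch H (f v) (f x) (f y) (f z)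
  branch (x≢y , x≢z , y≢z , vx , vy , vz) =
    f-injective x≢y , f-injective x≢z , f-injective y≢z , joined vx , joined vy , joined vz
  transport : ∀ c → invariant c G → invariant c H
  transport zero (i , iso) = f i , isolated iso
  transport (suc zero) (i , j , i≢j , iso-i , iso-j) = f i , f j , f-injective i≢j , isolated iso-i , isolated iso-j
  transport (suc (suc zero)) (v , x , y , z , b) = f v , f x , f y , f z , branch b
  transport (suc (suc (suc zero))) (v , x , y , z , b , hx , hy) =
    f v , f x , f y , f z , branch b , hangs hx , hangs hy

Profile : ∀ {n} → Graph n → Vec Bool 4 → Set
Profile G bs = ∀ c → Reflects (invariant c G) (Vec.lookup bs c)

reflects-⇔ : ∀ {A B : Set} {b} → (A → B) → (B → A) → Reflects A b → Reflects B b
reflects-⇔ to from (ofʸ a)  = ofʸ (to a)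
reflects-⇔ to from (ofⁿ ¬a) = ofⁿ (λ b → ¬a (from b))

profile-unique : ∀ {n} {G G′ R : Graph n} {bs bs′} → Isomorphic G R → Isomorphic G′ R →
  Profile G bs → Profile G′ bs′ → bs ≡ bs′
profile-unique {G = G} {G′} {R} {bs} {bs′} G≅R G′≅R profile profile′ =
  trans (sym (tabulate∘lookup bs)) (trans (tabulate-cong same) (tabulate∘lookup bs′))
  where
  G≅G′ : ∀ c → invariant c G → invariant c G′
  G≅G′ c = invariant-transport {H = G′} c (isomorphic-sym {G = G′} {R} G′≅R)
         ∘ invariant-transport {H = R} c G≅R
  G′≅G : ∀ c → invariant c G′ → invariant c G
  G′≅G c = invariant-transport {H = G} c (isomorphic-sym {G = G} {R} G≅R)
         ∘ invariant-transport {H = R} c G′≅R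
  same : ∀ c → Vec.lookup bs c ≡ Vec.lookup bs′ c
  same c = det (reflects-⇔ (G≅G′ c) (G′≅G c) (profile c)) (profile′ c)

path-at : ∀ {p L c x} → PathFrom p L c → c ≤ x → x < L → Joined p x (suc x)
path-at {p} {L} {c} {x} path c≤x x<L = subst (λ z → Joined p z (suc z)) (m∸n+n≡m c≤x)
  (path (x ∸ c) (s≤s (subst (_< L) (sym (m∸n+n≡m c≤x)) x<L)))

last-edge : ∀ {p L c} → PathFrom p L c → c < L → Joined p (pred L) L
last-edge {L = suc L′} path (s≤s c≤L′) = path-at path c≤L′ (n<1+n L′)

path-neighbour : ∀ {p L c} → PathFrom p L c → c < L →
  ∀ x → c ≤ x → x < suc L → Σ ℕ λ y → (y < suc L) × Joined p x y
path-neighbour {p} {L} {c} path c<L x c≤x x≤L with x <? L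
... | yes x<L = suc x , s≤s x<L , path-at path c≤x x<L
... | no  x≮L = pred L , s≤s pred[n]≤n , subst (λ z → Joined p z (pred L))
  (≤-antisym (≮⇒≥ x≮L) (≤-pred x≤L)) (joined-sym {p} {pred L} {L} (last-edge path c<L))

module ForestFacts (p : Parent) (inc : Increasing p) (L : ℕ) where

  G : Graph (suc L)
  G = forestOf p inc (suc L)

  adj-toFin : ∀ {x y} → x < suc L → y < suc L → adj G (toFin x) (toFin y) ≡ linked p x y
  adj-toFin {x} {y} x≤L y≤L = cong₂ (linked p) (toℕ-toFin x x≤L) (toℕ-toFin y y≤L)

  toFin-≢ : ∀ {x y} → x < suc L → y < suc L → x ≢ y → toFin {L} x ≢ toFin y
  toFin-≢ {x} {y} x≤L y≤L x≢y eq =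
    x≢y (trans (sym (toℕ-toFin x x≤L)) (trans (cong toℕ eq) (toℕ-toFin y y≤L)))

  isolated : ∀ {x} → x < suc L → (∀ w → linked p x w ≡ false) → Isolated G (toFin x)
  isolated {x} x≤L none w = trans (cong (λ z → linked p z (toℕ w)) (toℕ-toFin x x≤L)) (none (toℕ w))

  isolated-below : ∀ c → (∀ x → c ≤ x → x < suc L → Σ ℕ λ y → (y < suc L) × Joined p x y) →
    ∀ i → Isolated G i → toℕ i < c
  isolated-below c covered i iso with toℕ i <? c
  ... | yes i<c = i<c
  ... | no  i≮c with covered (toℕ i) (≮⇒≥ i≮c) (toℕ<n i)
  ...   | y , y≤L , joined = ⊥-elim (false≢true (trans (sym (iso (toFin y)))
            (trans (cong (linked p (toℕ i)) (toℕ-toFin y y≤L)) joined)))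

  branch : ∀ {v x y z} → v < suc L → x < suc L → y < suc L → z < suc L →
    x ≢ y → x ≢ z → y ≢ z → Joined p v x → Joined p v y → Joined p v z →
    Branch G (toFin v) (toFin x) (toFin y) (toFin z)
  branch v≤L x≤L y≤L z≤L x≢y x≢z y≢z vx vy vz =
    toFin-≢ x≤L y≤L x≢y , toFin-≢ x≤L z≤L x≢z , toFin-≢ y≤L z≤L y≢z ,
    trans (adj-toFin v≤L x≤L) vx , trans (adj-toFin v≤L y≤L) vy , trans (adj-toFin v≤L z≤L) vz

  branch⁻ : ∀ {v x y z} → Branch G v x y z → BranchAt p (toℕ v)
  branch⁻ {v} {x} {y} {z} (x≢y , x≢z , y≢z , vx , vy , vz) =
    toℕ x , toℕ y , toℕ z , (λ eq → x≢y (toℕ-injective eq)) , (λ eq → x≢z (toℕ-injective eq)) ,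
    (λ eq → y≢z (toℕ-injective eq)) , vx , vy , vz

  hangs : ∀ {x v} → x < suc L → v < suc L → (∀ w → Joined p x w → w ≡ v) → HangsAt G (toFin x) (toFin v)
  hangs {x} {v} x≤L v≤L only w joined = toℕ-injective (trans
    (only (toℕ w) (trans (cong (λ z → linked p z (toℕ w)) (sym (toℕ-toFin x x≤L))) joined))
    (sym (toℕ-toFin v v≤L)))

  hangs⁻ : ∀ {x v} → HangsAt G x v → ∀ w → w < suc L → Joined p (toℕ x) w → w ≡ toℕ v
  hangs⁻ {x} {v} h w w≤L joined = trans (sym (toℕ-toFin w w≤L))
    (cong toℕ (h (toFin w) (trans (cong (linked p (toℕ x)) (toℕ-toFin w w≤L)) joined)))

two⇒one : ∀ {n} {G : Graph n} → HasTwoIsolated G → HasIsolated G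
two⇒one (i , _ , _ , iso , _) = i , iso

cherry⇒branch : ∀ {n} {G : Graph n} → HasCherry G → HasBranch G
cherry⇒branch (v , x , y , z , b , _ , _) = v , x , y , z , b

profile-of : ∀ {n} {G : Graph n} {b₀ b₁ b₂ b₃} →
  Reflects (HasIsolated G) b₀ → Reflects (HasTwoIsolated G) b₁ →
  Reflects (HasBranch G) b₂ → Reflects (HasCherry G) b₃ → Profile G (b₀ ∷ᵥ b₁ ∷ᵥ b₂ ∷ᵥ b₃ ∷ᵥ []ᵥ)
profile-of r₀ r₁ r₂ r₃ zero                   = r₀
profile-of r₀ r₁ r₂ r₃ (suc zero)             = r₁
profile-of r₀ r₁ r₂ r₃ (suc (suc zero))       = r₂
profile-of r₀ r₁ r₂ r₃ (suc (suc (suc zero))) = r₃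

dotsPath-no-branch : ∀ a v → ¬ BranchAt (dotsPath a) v
dotsPath-no-branch a v = succ-pred-only {dotsPath a} {v} λ w joined → Sum.map proj₁ proj₁ (dotsPath-joined a v w joined)

pendant-covered : ∀ a h L → 2 + a ≤ h → h < suc L → suc a < L →
  ∀ x → a ≤ x → x < suc L → Σ ℕ λ y → (y < suc L) × Joined (pendantAt a h) x y
pendant-covered a h L 2+a≤h h≤L a+1<L x a≤x x≤L with x ≟ a
... | yes refl = h , h≤L , linked-up (pendantAt a h) a h (pendant-at a h)
... | no  x≢a  = path-neighbour (pendant-path a h L) a+1<L x (≤∧≢⇒< a≤x (λ a≡x → x≢a (sym a≡x))) x≤L

-- 9. The six model forests on {0, …, 5 + k}.

record Model (L : ℕ) (bs : Vec Bool 4) : Set where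
  field
    parent     : Parent
    increasing : Increasing parent
    auts       : List (ℕ → ℕ)
    lists      : ListsAutℕ parent (suc L) auts
    profile    : Profile (forestOf parent increasing (suc L)) bs

-- Their profiles: isolated vertex, two isolated vertices, branch vertex, cherry.
profiles : Fin 6 → Vec Bool 4
profiles zero                               = false ∷ᵥ false ∷ᵥ false ∷ᵥ false ∷ᵥ []ᵥ
profiles (suc zero)                         = true  ∷ᵥ false ∷ᵥ false ∷ᵥ false ∷ᵥ []ᵥ
profiles (suc (suc zero))                   = true  ∷ᵥ true  ∷ᵥ false ∷ᵥ false ∷ᵥ []ᵥ
profiles (suc (suc (suc zero)))             = false ∷ᵥ false ∷ᵥ true  ∷ᵥ true  ∷ᵥ []ᵥ
profiles (suc (suc (suc (suc zero))))       = true  ∷ᵥ false ∷ᵥ true  ∷ᵥ true  ∷ᵥ []ᵥ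
profiles (suc (suc (suc (suc (suc zero))))) = false ∷ᵥ false ∷ᵥ true  ∷ᵥ false ∷ᵥ []ᵥ

module Models (k : ℕ) where

  L : ℕ
  L = 5 + k

  inner : ∀ x {x<5 : True (x <? 5)} → x < L
  inner x {x<5} = ≤-trans (toWitness x<5) (m≤m+n 5 k)
  vertex : ∀ x {x<6 : True (x <? 6)} → x < suc L
  vertex x {x<6} = ≤-trans (toWitness x<6) (m≤m+n 6 k)

  path : Model L (profiles zero)
  path = record { parent = dotsPath 0 ; increasing = dotsPath-increasing 0 ; auts = path-auts L
    ; lists = path-lists L (inner 0) ; profile = profile-of {G = G}
        (ofⁿ no-isolated) (ofⁿ (λ two → no-isolated (two⇒one {G = G} two)))
        (ofⁿ no-branch) (ofⁿ (λ cherry → no-branch (cherry⇒branch {G = G} cherry))) }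
    where
    open ForestFacts (dotsPath 0) (dotsPath-increasing 0) L
    no-isolated : ¬ HasIsolated G
    no-isolated (i , iso) with isolated-below 0 (path-neighbour (dotsPath-path 0 L) (inner 0)) i iso
    ... | ()
    no-branch : ¬ HasBranch G
    no-branch (v , _ , _ , _ , b) = dotsPath-no-branch 0 (toℕ v) (branch⁻ b)

  dotPath : Model L (profiles (suc zero))
  dotPath = record { parent = dotsPath 1 ; increasing = dotsPath-increasing 1 ; auts = dotPath-auts L
    ; lists = dotPath-lists L (inner 1) ; profile = profile-of {G = G}
        (ofʸ (toFin 0 , isolated (vertex 0) (λ w → dotsPath-isolated 1 0 w (s≤s z≤n))))
        (ofⁿ not-two) (ofⁿ no-branch) (ofⁿ (λ cherry → no-branch (cherry⇒branch {G = G} cherry))) }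
    where
    open ForestFacts (dotsPath 1) (dotsPath-increasing 1) L
    at-0 : ∀ i → Isolated G i → toℕ i ≡ 0
    at-0 i iso = n<1⇒n≡0 (isolated-below 1 (path-neighbour (dotsPath-path 1 L) (inner 1)) i iso)
    not-two : ¬ HasTwoIsolated G
    not-two (i , j , i≢j , iso-i , iso-j) = i≢j (toℕ-injective (trans (at-0 i iso-i) (sym (at-0 j iso-j))))
    no-branch : ¬ HasBranch G
    no-branch (v , _ , _ , _ , b) = dotsPath-no-branch 1 (toℕ v) (branch⁻ b)

  twoDotsPath : Model L (profiles (suc (suc zero)))
  twoDotsPath = record { parent = dotsPath 2 ; increasing = dotsPath-increasing 2 ; auts = twoDotsPath-auts L
    ; lists = twoDotsPath-lists L (inner 2) ; profile = profile-of {G = G}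
        (ofʸ (two⇒one {G = G} two)) (ofʸ two) (ofⁿ no-branch) (ofⁿ (λ cherry → no-branch (cherry⇒branch {G = G} cherry))) }
    where
    open ForestFacts (dotsPath 2) (dotsPath-increasing 2) L
    two : HasTwoIsolated G
    two = toFin 0 , toFin 1 , toFin-≢ (vertex 0) (vertex 1) (λ ()) ,
      isolated (vertex 0) (λ w → dotsPath-isolated 2 0 w (s≤s z≤n)) ,
      isolated (vertex 1) (λ w → dotsPath-isolated 2 1 w (s≤s (s≤s z≤n)))
    no-branch : ¬ HasBranch G
    no-branch (v , _ , _ , _ , b) = dotsPath-no-branch 2 (toℕ v) (branch⁻ b)

  fork-cherry : ∀ a {3+a<6 : True (3 + a <? 6)} → HasCherry (ForestFacts.G (forkAt a) (fork-increasing a) L)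
  fork-cherry a {3+a<6} = toFin (2 + a) , toFin a , toFin (1 + a) , toFin (3 + a) ,
    branch (at 2) (at 0) (at 1) (at 3) (apart (λ ())) (apart (λ ())) (apart (λ ()))
      (fork-leaf-edge₀ a) (fork-leaf-edge₁ a) (pendant-path a (2 + a) L 1 (at 3)) ,
    hangs (at 0) (at 2) (pendant-leaf a (2 + a) ≤-refl) , hangs (at 1) (at 2) (pendant-start a (2 + a) ≤-refl)
    where
    open ForestFacts (forkAt a) (fork-increasing a) L
    at : ∀ c {c≤3 : True (c ≤? 3)} → c + a < suc L
    at c {c≤3} = ≤-trans (s≤s (+-monoˡ-≤ a (toWitness c≤3))) (vertex (3 + a) {3+a<6})
    apart : ∀ {c d} → c ≢ d → c + a ≢ d + a
    apart {c} {d} c≢d eq = c≢d (+-cancelʳ-≡ a c d eq)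

  fork : Model L (profiles (suc (suc (suc zero))))
  fork = record { parent = forkAt 0 ; increasing = fork-increasing 0 ; auts = fork-auts
    ; lists = fork-lists L (inner 3) ; profile = profile-of {G = G}
        (ofⁿ no-isolated) (ofⁿ (λ two → no-isolated (two⇒one {G = G} two)))
        (ofʸ (cherry⇒branch {G = G} (fork-cherry 0))) (ofʸ (fork-cherry 0)) }
    where
    open ForestFacts (forkAt 0) (fork-increasing 0) L
    no-isolated : ¬ HasIsolated G
    no-isolated (i , iso) with isolated-below 0 (pendant-covered 0 2 L ≤-refl (vertex 2) (inner 1)) i iso
    ... | ()

  dotFork : Model L (profiles (suc (suc (suc (suc zero)))))
  dotFork = record { parent = forkAt 1 ; increasing = fork-increasing 1 ; auts = dotFork-auts
    ; lists = dotFork-lists L (m≤m+n 5 k) ; profile = profile-of {G = G}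
        (ofʸ (toFin 0 , isolated (vertex 0) (λ w → pendant-isolated 1 3 ≤-refl 0 w (s≤s z≤n))))
        (ofⁿ not-two) (ofʸ (cherry⇒branch {G = G} (fork-cherry 1))) (ofʸ (fork-cherry 1)) }
    where
    open ForestFacts (forkAt 1) (fork-increasing 1) L
    at-0 : ∀ i → Isolated G i → toℕ i ≡ 0
    at-0 i iso = n<1⇒n≡0 (isolated-below 1 (pendant-covered 1 3 L ≤-refl (vertex 3) (inner 2)) i iso)
    not-two : ¬ HasTwoIsolated G
    not-two (i , j , i≢j , iso-i , iso-j) = i≢j (toℕ-injective (trans (at-0 i iso-i) (sym (at-0 j iso-j))))

  spur-model : Model L (profiles (suc (suc (suc (suc (suc zero))))))
  spur-model = record { parent = spur ; increasing = pendant-increasing 0 3 2≤3 ; auts = spur-auts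
    ; lists = spur-lists L (m≤m+n 5 k) ; profile = profile-of {G = G}
        (ofⁿ no-isolated) (ofⁿ (λ two → no-isolated (two⇒one {G = G} two)))
        (ofʸ (toFin 3 , toFin 0 , toFin 2 , toFin 4 , branch-at-3)) (ofⁿ no-cherry) }
    where
    2≤3 : 2 ≤ 3
    2≤3 = s≤s (s≤s z≤n)
    open ForestFacts spur (pendant-increasing 0 3 2≤3) L
    no-isolated : ¬ HasIsolated G
    no-isolated (i , iso) with isolated-below 0 (pendant-covered 0 3 L 2≤3 (vertex 3) (inner 1)) i iso
    ... | ()
    edge-2-3 : Joined spur 2 3
    edge-2-3 = pendant-path 0 3 L 1 (vertex 3)
    branch-at-3 : Branch G (toFin 3) (toFin 0) (toFin 2) (toFin 4)
    branch-at-3 = branch (vertex 3) (vertex 0) (vertex 2) (vertex 4) (λ ()) (λ ()) (λ ())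
      (joined-sym {spur} {0} {3} (linked-up spur 0 3 refl)) (joined-sym {spur} {2} {3} edge-2-3)
      (pendant-path 0 3 L 2 (vertex 4))
    -- a leaf hanging at the branch vertex 3 can only be 0: 2 and 4 have further neighbours
    leaf-is-0 : ∀ {v x} → toℕ v ≡ 3 → adj G v x ≡ true → HangsAt G x v → toℕ x ≡ 0
    leaf-is-0 {v} {x} v≡3 vx hx with pendant-hub 0 3 2≤3 (toℕ x) (subst (λ u → Joined spur u (toℕ x)) v≡3 vx)
    ... | inj₁ (inj₁ x≡0) = x≡0
    ... | inj₁ (inj₂ x≡2) = ⊥-elim (1≢3 (trans (hangs⁻ hx 1 (vertex 1)
            (subst (λ u → Joined spur u 1) (sym x≡2) (joined-sym {spur} {1} {2} (pendant-path 0 3 L 0 (vertex 2))))) v≡3))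
      where
      1≢3 : 1 ≢ 3
      1≢3 ()
    ... | inj₂ x≡4 = ⊥-elim (5≢3 (trans (hangs⁻ hx 5 (vertex 5)
            (subst (λ u → Joined spur u 5) (sym x≡4) (pendant-path 0 3 L 3 (vertex 5)))) v≡3))
      where
      5≢3 : 5 ≢ 3
      5≢3 ()
    no-cherry : ¬ HasCherry G
    no-cherry (v , x , y , z , b@(x≢y , _ , _ , vx , vy , _) , hx , hy) =
      x≢y (toℕ-injective (trans (leaf-is-0 v≡3 vx hx) (sym (leaf-is-0 v≡3 vy hy))))
      where
      v≡3 : toℕ v ≡ 3
      v≡3 = pendant-only-branch 0 3 2≤3 (toℕ v) (branch⁻ b)

-- 1/m as an unnormalised rational (0 for m = 0, matching `inv`).
unit : ℕ → ℚᵘ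
unit zero    = 0ℚᵘ
unit (suc m) = mkℚᵘ (ℤ.+ 1) m

inv≃unit : ∀ m → toℚᵘ (inv m) ≃ᵘ unit m
inv≃unit zero    = ≃ᵘ-refl
inv≃unit (suc m) = toℚᵘ-fromℚᵘ (mkℚᵘ (ℤ.+ 1) m)

unit≥0 : ∀ m → 0ℚᵘ ≤ᵘ unit m
unit≥0 zero    = ≤ᵘ-refl
unit≥0 (suc m) = nonNegative⁻¹ _

inv≥0 : ∀ m → 0ℚ ℚ.≤ inv m
inv≥0 m = toℚᵘ-cancel-≤ (≤ᵘ-respʳ-≃ (≃ᵘ-sym (inv≃unit m)) (unit≥0 m))

unit-antitone : ∀ {m n} → 1 ≤ m → m ≤ n → unit n ≤ᵘ unit m
unit-antitone {suc m} {suc n} _ m≤n =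
  *≤* (subst₂ ℤ._≤_ (sym (ℤP.*-identityˡ _)) (sym (ℤP.*-identityˡ _)) (ℤ.+≤+ m≤n))

inv-antitone : ∀ {m n} → 1 ≤ m → m ≤ n → inv n ℚ.≤ inv m
inv-antitone {m} {n} 1≤m m≤n = toℚᵘ-cancel-≤
  (≤ᵘ-respˡ-≃ (≃ᵘ-sym (inv≃unit n)) (≤ᵘ-respʳ-≃ (≃ᵘ-sym (inv≃unit m)) (unit-antitone 1≤m m≤n)))

twice-unit≤ : ∀ {M m} → 1 ≤ m → 2 * m ≤ M → unit M +ᵘ unit M ≤ᵘ unit m
twice-unit≤ {suc M′} {suc m′} _ 2m≤M = *≤* (subst₂ ℤ._≤_ (sym lhs) (sym rhs) (ℤ.+≤+ M+M·m≤M·M))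
  where
  M m : ℕ
  M = suc M′
  m = suc m′
  lhs : ℚᵘ.numerator (unit M +ᵘ unit M) ℤ.* ℚᵘ.denominator (unit m) ≡ ℤ.+ ((M + M) * m)
  lhs = trans (cong₂ (λ a b → (a ℤ.+ b) ℤ.* ℤ.+ m) (ℤP.*-identityˡ (ℤ.+ M)) (ℤP.*-identityˡ (ℤ.+ M)))
          (trans (cong (ℤ._* ℤ.+ m) (sym (ℤP.pos-+ M M))) (sym (ℤP.pos-* (M + M) m)))
  rhs : ℚᵘ.numerator (unit m) ℤ.* ℚᵘ.denominator (unit M +ᵘ unit M) ≡ ℤ.+ (M * M)
  rhs = ℤP.*-identityˡ (ℤ.+ (M * M))
  M+M·m≤M·M : (M + M) * m ≤ M * M
  M+M·m≤M·M = subst (_≤ M * M) (trans (*-distribˡ-+ M m m) (sym (*-distribʳ-+ m M M)))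
    (*-monoʳ-≤ M (subst (_≤ M) (cong (m +_) (+-identityʳ m)) 2m≤M))

eSumᵘ : ℕ → ℚᵘ
eSumᵘ zero    = unit (0 !)
eSumᵘ (suc N) = eSumᵘ N +ᵘ unit (suc N !)

eSum≃eSumᵘ : ∀ N → toℚᵘ (eSum N) ≃ᵘ eSumᵘ N
eSum≃eSumᵘ zero    = inv≃unit 1
eSum≃eSumᵘ (suc N) = ≃ᵘ-trans (toℚᵘ-homo-+ (eSum N) (inv (suc N !))) (+ᵘ-cong (eSum≃eSumᵘ N) (inv≃unit (suc N !)))

-- The tail after the term 1/(5+d)! is at most twice the next term, since
-- consecutive terms at least halve: eSum (5 + d) + 2/(6 + d)! decreases in d.
tail-bound : ∀ d → eSumᵘ (5 + d) +ᵘ (unit ((6 + d) !) +ᵘ unit ((6 + d) !)) ≤ᵘ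
                   eSumᵘ 5 +ᵘ (unit (6 !) +ᵘ unit (6 !))
tail-bound zero    = ≤ᵘ-refl
tail-bound (suc d) = ≤ᵘ-trans step (tail-bound d)
  where
  m M : ℕ
  m = (6 + d) !
  M = (7 + d) !
  step : eSumᵘ (6 + d) +ᵘ (unit M +ᵘ unit M) ≤ᵘ eSumᵘ (5 + d) +ᵘ (unit m +ᵘ unit m)
  step = ≤ᵘ-respˡ-≃ (≃ᵘ-sym (+ᵘ-assoc (eSumᵘ (5 + d)) (unit m) (unit M +ᵘ unit M)))
           (+ᵘ-monoʳ-≤ (eSumᵘ (5 + d)) (+ᵘ-monoʳ-≤ (unit m)
             (twice-unit≤ (1≤n! (6 + d)) (*-monoˡ-≤ m {2} {7 + d} (s≤s (s≤s z≤n))))))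

x≤x+y : ∀ x y → 0ℚᵘ ≤ᵘ y → x ≤ᵘ x +ᵘ y
x≤x+y x y y≥0 = ≤ᵘ-respˡ-≃ (+ᵘ-identityʳ x) (+ᵘ-monoʳ-≤ x y≥0)

eSum≤68/25 : ∀ N → eSum N ℚ.≤ ℤ.+ 68 / 25
eSum≤68/25 N = toℚᵘ-cancel-≤ (≤ᵘ-respˡ-≃ (≃ᵘ-sym (eSum≃eSumᵘ N))
  (≤ᵘ-respʳ-≃ (≃ᵘ-sym (toℚᵘ-fromℚᵘ (mkℚᵘ (ℤ.+ 68) 24))) (bound N)))
  where
  bound : ∀ N → eSumᵘ N ≤ᵘ mkℚᵘ (ℤ.+ 68) 24
  bound 0 = toWitness {a? = eSumᵘ 0 ≤ᵘ? mkℚᵘ (ℤ.+ 68) 24} _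
  bound 1 = toWitness {a? = eSumᵘ 1 ≤ᵘ? mkℚᵘ (ℤ.+ 68) 24} _
  bound 2 = toWitness {a? = eSumᵘ 2 ≤ᵘ? mkℚᵘ (ℤ.+ 68) 24} _
  bound 3 = toWitness {a? = eSumᵘ 3 ≤ᵘ? mkℚᵘ (ℤ.+ 68) 24} _
  bound 4 = toWitness {a? = eSumᵘ 4 ≤ᵘ? mkℚᵘ (ℤ.+ 68) 24} _
  bound (suc (suc (suc (suc (suc d))))) =
    ≤ᵘ-trans (x≤x+y (eSumᵘ (5 + d)) _ (≤ᵘ-trans (unit≥0 ((6 + d) !)) (x≤x+y _ _ (unit≥0 ((6 + d) !)))))
      (≤ᵘ-trans (tail-bound d) (toWitness {a? = eSumᵘ 5 +ᵘ (unit (6 !) +ᵘ unit (6 !)) ≤ᵘ? mkℚᵘ (ℤ.+ 68) 24} _))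

sum-mono : ∀ {A : Set} {f g : A → ℚ} (xs : List A) → (∀ x → f x ℚ.≤ g x) →
  sumℚ (map f xs) ℚ.≤ sumℚ (map g xs)
sum-mono []       f≤g = ℚP.≤-refl
sum-mono (x ∷ xs) f≤g = ℚP.+-mono-≤ (f≤g x) (sum-mono xs f≤g)

sum-at : ∀ {A : Set} → (A → ℚ) → (xs : List A) → List (Fin (length xs)) → ℚ
sum-at f xs is = sumℚ (map (λ i → f (lookup xs i)) is)

module _ {A : Set} (f : A → ℚ) (f≥0 : ∀ a → 0ℚ ℚ.≤ f a) where

  private
    tail-positions : ∀ {n} → List (Fin (suc n)) → List (Fin n)
    tail-positions []           = []
    tail-positions (zero  ∷ is) = tail-positions is
    tail-positions (suc j ∷ is) = j ∷ tail-positions is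

    tail-positions-avoid : ∀ {n} (j : Fin n) is → All.All (λ i → suc j ≢ i) is →
      All.All (λ i → j ≢ i) (tail-positions is)
    tail-positions-avoid j []           _         = []
    tail-positions-avoid j (zero  ∷ is) (_ ∷ ps)  = tail-positions-avoid j is ps
    tail-positions-avoid j (suc i ∷ is) (p ∷ ps)  = (λ e → p (cong suc e)) ∷ tail-positions-avoid j is ps

    tail-positions-unique : ∀ {n} (is : List (Fin (suc n))) → Unique is → Unique (tail-positions is)
    tail-positions-unique []           _       = []
    tail-positions-unique (zero  ∷ is) (_ ∷ u) = tail-positions-unique is u
    tail-positions-unique (suc j ∷ is) (p ∷ u) = tail-positions-avoid j is p ∷ tail-positions-unique is u

    sum-at-tail : ∀ x xs (is : List (Fin (suc (length xs)))) → All.All (λ i → zero ≢ i) is →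
      sum-at f (x ∷ xs) is ≡ sum-at f xs (tail-positions is)
    sum-at-tail x xs []           _        = refl
    sum-at-tail x xs (zero  ∷ is) (p ∷ _)  = ⊥-elim (p refl)
    sum-at-tail x xs (suc j ∷ is) (_ ∷ ps) = cong (f (lookup xs j) ℚ.+_) (sum-at-tail x xs is ps)

    sum-at-cons : ∀ x xs (is : List (Fin (suc (length xs)))) → Unique is →
      sum-at f (x ∷ xs) is ℚ.≤ f x ℚ.+ sum-at f xs (tail-positions is)
    sum-at-cons x xs []           _       = subst (0ℚ ℚ.≤_) (sym (ℚP.+-identityʳ (f x))) (f≥0 x)
    sum-at-cons x xs (zero  ∷ is) (p ∷ _) = ℚP.≤-reflexive (cong (f x ℚ.+_) (sum-at-tail x xs is p))
    sum-at-cons x xs (suc j ∷ is) (_ ∷ u) =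
      subst (f (lookup xs j) ℚ.+ sum-at f (x ∷ xs) is ℚ.≤_) (swap (f (lookup xs j)) (f x) _)
        (ℚP.+-monoʳ-≤ (f (lookup xs j)) (sum-at-cons x xs is u))
      where
      swap : ∀ a b c → a ℚ.+ (b ℚ.+ c) ≡ b ℚ.+ (a ℚ.+ c)
      swap a b c = trans (sym (ℚP.+-assoc a b c)) (trans (cong (ℚ._+ c) (ℚP.+-comm a b)) (ℚP.+-assoc b a c))

  sum-at≤sum : ∀ xs (is : List (Fin (length xs))) → Unique is → sum-at f xs is ℚ.≤ sumℚ (map f xs)
  sum-at≤sum []       []  _ = ℚP.≤-refl
  sum-at≤sum (x ∷ xs) is  u = ℚP.≤-trans (sum-at-cons x xs is u)
    (ℚP.+-monoʳ-≤ (f x) (sum-at≤sum xs (tail-positions is) (tail-positions-unique is u)))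

profiles-injective : ∀ i j → profiles i ≡ profiles j → i ≡ j
profiles-injective = toWitness
  {a? = all? λ i → all? λ j → Vecₚ.≡-dec Boolₚ._≟_ (profiles i) (profiles j) →-dec (i Fin.≟ j)} _

module _ (k : ℕ) where
  open Models k

  model : (i : Fin 6) → Model L (profiles i)
  model zero                               = path
  model (suc zero)                         = dotPath
  model (suc (suc zero))                   = twoDotsPath
  model (suc (suc (suc zero)))             = fork
  model (suc (suc (suc (suc zero))))       = dotFork
  model (suc (suc (suc (suc (suc zero))))) = spur-model

  forest : Fin 6 → Graph (6 + k)
  forest i = forestOf (Model.parent (model i)) (Model.increasing (model i)) (6 + k)

  aut-bound : Fin 6 → ℕ
  aut-bound i = length (Model.auts (model i))

  68/25<Σ1/aut-bound : ℤ.+ 68 / 25 ℚ.< sumℚ (map (λ i → inv (aut-bound i)) (allFin 6))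
  68/25<Σ1/aut-bound = toWitness {a? = ℤ.+ 68 / 25 ℚP.<? sumℚ (map (λ i → inv (aut-bound i)) (allFin 6))} _

  -- Each model is isomorphic to an entry of a complete list of representatives;
  -- these entries are distinct (the profiles differ) and have few automorphisms.
  module _ (reps : List (Graph (6 + k)))
           (complete : ∀ G → IsForest G → ∃[ r ] Isomorphic G (lookup reps r)) where

    representative : ∀ i → ∃[ r ] Isomorphic (forest i) (lookup reps r)
    representative i =
      complete (forest i) (forestOf-isForest (Model.parent (model i)) (Model.increasing (model i)) (6 + k))

    rep : Fin 6 → Fin (length reps)
    rep i = proj₁ (representative i)

    rep-injective : ∀ {i j} → rep i ≡ rep j → i ≡ j
    rep-injective {i} {j} same = profiles-injective i j
      (profile-unique {R = lookup reps (rep i)} (proj₂ (representative i))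
        (subst (λ r → Isomorphic (forest j) (lookup reps r)) (sym same) (proj₂ (representative j)))
        (Model.profile (model i)) (Model.profile (model j)))

    aut-rep≤ : ∀ i → aut (lookup reps (rep i)) ≤ aut-bound i
    aut-rep≤ i = subst (aut (lookup reps (rep i)) ≤_) (length-map liftFin auts)
      (aut≤-via-iso {G = forest i} {H = lookup reps (rep i)} (proj₂ (representative i))
        (map liftFin auts) (lists-fromℕ parent increasing auts lists))
      where open Model (model i)

    Σ1/aut-bound≤ : sumℚ (map (λ i → inv (aut-bound i)) (allFin 6)) ℚ.≤ sumℚ (map (λ F → inv (aut F)) reps)
    Σ1/aut-bound≤ = begin
      sumℚ (map (λ i → inv (aut-bound i)) (allFin 6))
        ≤⟨ sum-mono (allFin 6) (λ i → inv-antitone (aut≥1 (lookup reps (rep i))) (aut-rep≤ i)) ⟩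
      sumℚ (map (λ i → inv (aut (lookup reps (rep i)))) (allFin 6))
        ≡⟨ cong sumℚ (map-∘ {g = λ r → inv (aut (lookup reps r))} {f = rep} (allFin 6)) ⟩
      sum-at (λ F → inv (aut F)) reps (map rep (allFin 6))
        ≤⟨ sum-at≤sum (λ F → inv (aut F)) (λ F → inv≥0 (aut F)) reps (map rep (allFin 6))
             (Uniqueₚ.map⁺ rep-injective (Uniqueₚ.allFin⁺ 6)) ⟩
      sumℚ (map (λ F → inv (aut F)) reps) ∎
      where open ℚP.≤-Reasoning

lemma4p6 : (n : ℕ) → 6 ≤ n → (reps : List (Graph n)) → ForestReps n reps →
    e< sumℚ (map (λ F → inv (aut F)) reps)
lemma4p6 _ (s≤s (s≤s (s≤s (s≤s (s≤s (s≤s (z≤n {n = k}))))))) reps (_ , complete , _) =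
  ℤ.+ 68 / 25 , ℚP.<-≤-trans (68/25<Σ1/aut-bound k) (Σ1/aut-bound≤ k reps complete) , eSum≤68/25
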